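{- Let $m$ be a positive integer and $p$ a prime with $p>m$; let $q=\lfloor p/m\rfloor$. Define $f_{m,p,i}$ ($0\le i\le\varphi(m)-1$) and $f_{m,p,i,j}$ ($0\le j\le q$) by $$\Phi_{mp}=\sum_{i=0}^{\varphi(m)-1}f_{m,p,i}\,x^{ip},\ \deg f_{m,p,i}<p,\qquad f_{m,p,i}=\sum_{j=0}^{q}f_{m,p,i,j}\,x^{jm},\ \deg f_{m,p,i,j}<m.$$ Then for every $0\le i\le\varphi(m)-1$, the maximum gap of $f_{m,p,i,0}$ satisfies $g(f_{m,p,i,0})\le\varphi(m)$.
   Context: $\Phi_n$ is the $n$-th cyclotomic polynomial and $\varphi$ is Euler's totient function. For a nonzero polynomial $f=c_1x^{e_1}+\cdots+c_tx^{e_t}$ with all $c_k\ne0$ and $e_1<\cdots<e_t$, the maximum gap is $g(f)=\max_{1\le k<t}(e_{k+1}-e_k)$ (taken to be $0$ if $t=1$). -}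

module Defs where

open import Data.Nat as ℕ using (ℕ; zero; suc; _∸_; _⊔_)
open import Data.Nat.Divisibility using (_∣?_)
open import Data.Nat.GCD using (gcd)
open import Data.Integer as ℤ using (ℤ; +_; -[1+_])
open import Data.List using (List; []; _∷_; map; filter; length; upTo; foldr; drop; _++_)
open import Data.Product using (_×_; _,_; proj₁; proj₂)
open import Relation.Nullary.Decidable using (¬?)

-- Polynomials over ℤ as coefficient lists, lowest degree first
-- (trailing zeros allowed; all notions below only use `coeff`).
Poly : Set
Poly = List ℤ

coeff : Poly → ℕ → ℤ
coeff []       _       = + 0
coeff (a ∷ _)  zero    = a
coeff (_ ∷ as) (suc k) = coeff as k

infixl 6 _+ₚ_ _-ₚ_
infixl 7 _*ₚ_

_+ₚ_ : Poly → Poly → Poly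
[]       +ₚ q        = q
(a ∷ p)  +ₚ []       = a ∷ p
(a ∷ p)  +ₚ (b ∷ q)  = (a ℤ.+ b) ∷ (p +ₚ q)

scale : ℤ → Poly → Poly
scale c = map (c ℤ.*_)

_-ₚ_ : Poly → Poly → Poly
p -ₚ q = p +ₚ scale (ℤ.- (+ 1)) q

_*ₚ_ : Poly → Poly → Poly
[]      *ₚ q = []
(a ∷ p) *ₚ q = scale a q +ₚ (+ 0 ∷ (p *ₚ q))

prodP : List Poly → Poly
prodP = foldr _*ₚ_ (+ 1 ∷ [])

replicate0 : ℕ → Poly
replicate0 zero    = []
replicate0 (suc n) = + 0 ∷ replicate0 n

xⁿ-1 : ℕ → Poly
xⁿ-1 zero    = []
xⁿ-1 (suc n) = -[1+ 0 ] ∷ (replicate0 n ++ (+ 1 ∷ []))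

-- First k coefficients of the power series a/b, for b with constant
-- term ±1 (so b₀⁻¹ = b₀).  When b divides a in ℤ[x] and k > deg(a/b),
-- this is exactly the polynomial quotient a/b.
sdiv : ℕ → Poly → Poly → Poly
sdiv zero    r b = []
sdiv (suc k) r b = c ∷ sdiv k (drop 1 (r -ₚ scale c b)) b
  where c = coeff b 0 ℤ.* coeff r 0

-- Cyclotomic polynomials, via  x^n - 1 = ∏_{d ∣ n} Φ_d :
-- Φ_n = (x^n - 1) / ∏_{d ∣ n, d < n} Φ_d  (exact division; deg Φ_n ≤ n).
-- cycTable k = [(1,Φ_1), …, (k,Φ_k)]
newCyc : ℕ → List (ℕ × Poly) → Poly
newCyc n tbl =
  sdiv (suc n) (xⁿ-1 n)
       (prodP (map proj₂ (filter (λ e → proj₁ e ∣? n) tbl)))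

cycTable : ℕ → List (ℕ × Poly)
cycTable zero    = []
cycTable (suc k) = cycTable k ++ ((suc k , newCyc (suc k) (cycTable k)) ∷ [])

-- Φ n is the n-th cyclotomic polynomial for n ≥ 1 (Φ 0 is a dummy value).
Φ : ℕ → Poly
Φ zero    = []
Φ (suc k) = newCyc (suc k) (cycTable k)

totient : ℕ → ℕ
totient m = length (filter (λ k → gcd k m ℕ.≟ 1) (map suc (upTo m)))

supportUpTo : ℕ → Poly → List ℕ
supportUpTo n f = filter (λ k → ¬? (coeff f k ℤ.≟ + 0)) (upTo n)

support : Poly → List ℕ
support f = supportUpTo (length f) f

maxGapList : List ℕ → ℕ
maxGapList (a ∷ b ∷ rest) = (b ∸ a) ⊔ maxGapList (b ∷ rest)
maxGapList _              = 0

g : Poly → ℕ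
g f = maxGapList (support f)

fmpi : ℕ → ℕ → ℕ → Poly
fmpi m p i = map (λ k → coeff (Φ (m ℕ.* p)) (i ℕ.* p ℕ.+ k)) (upTo p)

fmpij : ℕ → ℕ → ℕ → ℕ → Poly
fmpij m p i j = map (λ k → coeff (fmpi m p i) (j ℕ.* m ℕ.+ k)) (upTo m)

-- For p ∤ m, Φ_{mp} divides Φ_m(xᵖ), and the cofactor h is monic of degree pφ(m) - φ(mp) = φ(m).
-- Φ_m(xᵖ) has no terms strictly inside a block [ip, ip + p). If f_{m,p,i,0} had a nonzero coefficient
-- at a followed by φ(m) zeros, the coefficient of Φ_{mp} h at ip + a + φ(m) would equal that of Φ_{mp}
-- at ip + a, which is nonzero; but a + φ(m) < m < p puts this position strictly inside a block.
-- Since Φ n is defined by exact division, one first shows by induction on n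
-- that it is monic of degree φ(n) with Φ_n ∏_{d ∣ n, d < n} Φ_d = xⁿ - 1, using that distinct Φ_d
-- are coprime (via Bézout identities for xᵈ - 1 and xᵉ - 1) and that Σ_{d ∣ n} φ(d) = n.

module Submission where

open import Defs
open import Algebra.Bundles using (CommutativeRing)
import Algebra.Properties.CommutativeSemigroup as CommSemigroupProperties
open import Data.Empty using (⊥-elim)
open import Data.Integer as ℤ using (ℤ; 0ℤ; 1ℤ)
import Data.Integer.Properties as ℤP
open import Data.Integer.Tactic.RingSolver using (solve-∀)
open import Data.List using (List; []; _∷_; _++_; [_]; map; filter; length; drop; upTo; applyUpTo)
import Data.List.Properties as LP
open import Data.List.Relation.Unary.All as All using (All; []; _∷_)
import Data.List.Relation.Unary.All.Properties as AllP
open import Data.Maybe using (Maybe; nothing; just)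
open import Data.Nat as ℕ using (ℕ; zero; suc; _≤_; _<_; z≤n; s≤s; _∸_; _+_; _*_; NonZero)
import Data.Nat.Properties as ℕP
open import Data.Nat.Coprimality using (Coprime; coprime⇒gcd≡1; gcd≡1⇒coprime; coprime-divisor)
open import Data.Nat.Divisibility
  using (_∣_; _∣?_; divides; ∣m+n∣m⇒∣n; ∣m∣n⇒∣m+n; ∣m⇒∣m*n; ∣⇒≤; ∣-trans; ∣-refl; ∣-antisym; n∣m*n; m∣m*n)
open import Data.Nat.GCD
  using (gcd; gcd-GCD; module Bézout; gcd[m,n]∣m; gcd[m,n]∣n; gcd[m,n]≢0; gcd-zeroˡ; c*gcd[m,n]≡gcd[cm,cn])
open import Data.Nat.ListAction using (sum)
open import Data.Nat.ListAction.Properties using (sum-++)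
open import Data.Nat.Primality using (Prime; prime⇒irreducible; prime⇒nonTrivial)
open import Data.Product using (Σ; _×_; _,_; proj₁; proj₂)
open import Data.Sum using (inj₁; inj₂; [_,_]′)
open import Function using (_∘_; id)
open import Level using (0ℓ)
open import Relation.Binary.Bundles using (Setoid)
open import Relation.Binary.PropositionalEquality hiding ([_])
import Relation.Binary.Reasoning.Setoid as SetoidReasoning
open import Relation.Nullary using (¬_; Dec; yes; no)
open import Relation.Nullary.Decidable using (_×-dec_; ¬?; decidable-stable)
open import Relation.Unary using (Pred; Decidable)
open import Tactic.RingSolver.Core.AlmostCommutativeRing using (fromCommutativeRing)

-- Coefficientwise equality and the ring ℤ[x]

infix 4 _≈_
record _≈_ (p q : Poly) : Set where
  constructor mk≈
  field at : ∀ k → coeff p k ≡ coeff q k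
open _≈_ public

≈-refl : ∀ {p} → p ≈ p
≈-refl = mk≈ λ _ → refl

≈-reflexive : ∀ {p q} → p ≡ q → p ≈ q
≈-reflexive refl = ≈-refl

≈-sym : ∀ {p q} → p ≈ q → q ≈ p
≈-sym e = mk≈ λ k → sym (at e k)

≈-trans : ∀ {p q r} → p ≈ q → q ≈ r → p ≈ r
≈-trans e f = mk≈ λ k → trans (at e k) (at f k)

∷-cong : ∀ {a b p q} → a ≡ b → p ≈ q → a ∷ p ≈ b ∷ q
∷-cong refl e = mk≈ λ { zero → refl ; (suc k) → at e k }

1ₚ : Poly
1ₚ = 1ℤ ∷ []

const : ℤ → Poly
const c = c ∷ []

negₚ : Poly → Poly
negₚ = scale (ℤ.- 1ℤ)

coeff-+ₚ : ∀ p q k → coeff (p +ₚ q) k ≡ coeff p k ℤ.+ coeff q k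
coeff-+ₚ []      q       k       = sym (ℤP.+-identityˡ _)
coeff-+ₚ (a ∷ p) []      k       = sym (ℤP.+-identityʳ _)
coeff-+ₚ (a ∷ p) (b ∷ q) zero    = refl
coeff-+ₚ (a ∷ p) (b ∷ q) (suc k) = coeff-+ₚ p q k

coeff-scale : ∀ c p k → coeff (scale c p) k ≡ c ℤ.* coeff p k
coeff-scale c []      k       = sym (ℤP.*-zeroʳ c)
coeff-scale c (a ∷ p) zero    = refl
coeff-scale c (a ∷ p) (suc k) = coeff-scale c p k

coeff-negₚ : ∀ p k → coeff (negₚ p) k ≡ ℤ.- coeff p k
coeff-negₚ p k = trans (coeff-scale (ℤ.- 1ℤ) p k) (ℤP.-1*i≡-i (coeff p k))

coeff--ₚ : ∀ p q k → coeff (p -ₚ q) k ≡ coeff p k ℤ.- coeff q k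
coeff--ₚ p q k = trans (coeff-+ₚ p (negₚ q) k) (cong (λ z → coeff p k ℤ.+ z) (coeff-negₚ q k))

coeff-drop1 : ∀ p k → coeff (drop 1 p) k ≡ coeff p (suc k)
coeff-drop1 []      k = refl
coeff-drop1 (a ∷ p) k = refl

conv : (ℕ → ℤ) → (ℕ → ℤ) → ℕ → ℤ
conv f g zero    = f 0 ℤ.* g 0
conv f g (suc n) = f 0 ℤ.* g (suc n) ℤ.+ conv (f ∘ suc) g n

coeff-*ₚ : ∀ p q n → coeff (p *ₚ q) n ≡ conv (coeff p) (coeff q) n
coeff-*ₚ [] q zero = sym (ℤP.*-zeroˡ (coeff q 0))
coeff-*ₚ [] q (suc n) = trans (coeff-*ₚ [] q n)
  (sym (trans (cong (ℤ._+ conv (λ _ → 0ℤ) (coeff q) n) (ℤP.*-zeroˡ (coeff q (suc n)))) (ℤP.+-identityˡ _)))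
coeff-*ₚ (a ∷ p) q zero = trans (coeff-+ₚ (scale a q) (0ℤ ∷ (p *ₚ q)) 0)
  (trans (ℤP.+-identityʳ _) (coeff-scale a q 0))
coeff-*ₚ (a ∷ p) q (suc n) = trans (coeff-+ₚ (scale a q) (0ℤ ∷ (p *ₚ q)) (suc n))
  (cong₂ ℤ._+_ (coeff-scale a q (suc n)) (coeff-*ₚ p q n))

conv-cong : ∀ {f f′ g g′} → f ≗ f′ → g ≗ g′ → conv f g ≗ conv f′ g′
conv-cong ef eg zero    = cong₂ ℤ._*_ (ef 0) (eg 0)
conv-cong ef eg (suc n) = cong₂ ℤ._+_ (cong₂ ℤ._*_ (ef 0) (eg (suc n))) (conv-cong (ef ∘ suc) eg n)

conv-distribʳ : ∀ f f′ g n → conv (λ k → f k ℤ.+ f′ k) g n ≡ conv f g n ℤ.+ conv f′ g n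
conv-distribʳ f f′ g zero = ℤP.*-distribʳ-+ (g 0) (f 0) (f′ 0)
conv-distribʳ f f′ g (suc n) =
  trans (cong₂ ℤ._+_ (ℤP.*-distribʳ-+ (g (suc n)) (f 0) (f′ 0)) (conv-distribʳ (f ∘ suc) (f′ ∘ suc) g n))
        (CommSemigroupProperties.interchange ℤP.+-commutativeSemigroup (f 0 ℤ.* g (suc n)) (f′ 0 ℤ.* g (suc n)) _ _)

conv-scaleˡ : ∀ c f g n → conv (λ k → c ℤ.* f k) g n ≡ c ℤ.* conv f g n
conv-scaleˡ c f g zero = ℤP.*-assoc c (f 0) (g 0)
conv-scaleˡ c f g (suc n) =
  trans (cong₂ ℤ._+_ (ℤP.*-assoc c (f 0) (g (suc n))) (conv-scaleˡ c (f ∘ suc) g n))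
        (sym (ℤP.*-distribˡ-+ c _ _))

conv-zeroˡ : ∀ g n → conv (λ _ → 0ℤ) g n ≡ 0ℤ
conv-zeroˡ g zero    = ℤP.*-zeroˡ (g 0)
conv-zeroˡ g (suc n) = cong₂ ℤ._+_ (ℤP.*-zeroˡ (g (suc n))) (conv-zeroˡ g n)

conv-oneˡ : ∀ g n → conv (coeff 1ₚ) g n ≡ g n
conv-oneˡ g zero    = ℤP.*-identityˡ (g 0)
conv-oneˡ g (suc n) =
  trans (cong₂ ℤ._+_ (ℤP.*-identityˡ (g (suc n))) (conv-zeroˡ g n)) (ℤP.+-identityʳ (g (suc n)))

conv-suc : ∀ f g n → conv f g (suc n) ≡ conv f (g ∘ suc) n ℤ.+ f (suc n) ℤ.* g 0
conv-suc f g zero    = refl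
conv-suc f g (suc n) =
  trans (cong (λ z → f 0 ℤ.* g (suc (suc n)) ℤ.+ z) (conv-suc (f ∘ suc) g n))
        (sym (ℤP.+-assoc (f 0 ℤ.* g (suc (suc n))) (conv (f ∘ suc) (g ∘ suc) n) (f (suc (suc n)) ℤ.* g 0)))

conv-comm : ∀ f g n → conv f g n ≡ conv g f n
conv-comm f g zero    = ℤP.*-comm (f 0) (g 0)
conv-comm f g (suc n) =
  trans (cong (λ z → f 0 ℤ.* g (suc n) ℤ.+ z) (conv-comm (f ∘ suc) g n))
        (trans (swap (f 0) (g (suc n)) _) (sym (conv-suc g f n)))
  where
  swap : ∀ a b c → a ℤ.* b ℤ.+ c ≡ c ℤ.+ b ℤ.* a
  swap = solve-∀

conv-assoc : ∀ f g h n → conv (conv f g) h n ≡ conv f (conv g h) n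
conv-assoc f g h zero    = ℤP.*-assoc (f 0) (g 0) (h 0)
conv-assoc f g h (suc n) =
  trans (cong (λ z → conv f g 0 ℤ.* h (suc n) ℤ.+ z)
          (trans (conv-distribʳ (λ k → f 0 ℤ.* g (suc k)) (conv (f ∘ suc) g) h n)
                 (cong₂ ℤ._+_ (conv-scaleˡ (f 0) (g ∘ suc) h n) (conv-assoc (f ∘ suc) g h n))))
        (regroup (f 0) (g 0) (h (suc n)) (conv (g ∘ suc) h n) (conv (f ∘ suc) (conv g h) n))
  where
  regroup : ∀ a b c d e → a ℤ.* b ℤ.* c ℤ.+ (a ℤ.* d ℤ.+ e) ≡ a ℤ.* (b ℤ.* c ℤ.+ d) ℤ.+ e
  regroup = solve-∀

+ₚ-cong : ∀ {p p′ q q′} → p ≈ p′ → q ≈ q′ → p +ₚ q ≈ p′ +ₚ q′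
+ₚ-cong {p} {p′} {q} {q′} e f = mk≈ λ k →
  trans (coeff-+ₚ p q k) (trans (cong₂ ℤ._+_ (at e k) (at f k)) (sym (coeff-+ₚ p′ q′ k)))

+ₚ-comm : ∀ p q → p +ₚ q ≈ q +ₚ p
+ₚ-comm p q = mk≈ λ k →
  trans (coeff-+ₚ p q k) (trans (ℤP.+-comm (coeff p k) (coeff q k)) (sym (coeff-+ₚ q p k)))

+ₚ-assoc : ∀ p q r → (p +ₚ q) +ₚ r ≈ p +ₚ (q +ₚ r)
+ₚ-assoc p q r = mk≈ λ k → begin
  coeff ((p +ₚ q) +ₚ r) k                 ≡⟨ coeff-+ₚ (p +ₚ q) r k ⟩
  coeff (p +ₚ q) k ℤ.+ coeff r k          ≡⟨ cong (ℤ._+ coeff r k) (coeff-+ₚ p q k) ⟩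
  coeff p k ℤ.+ coeff q k ℤ.+ coeff r k   ≡⟨ ℤP.+-assoc (coeff p k) (coeff q k) (coeff r k) ⟩
  coeff p k ℤ.+ (coeff q k ℤ.+ coeff r k) ≡⟨ cong (λ z → coeff p k ℤ.+ z) (coeff-+ₚ q r k) ⟨
  coeff p k ℤ.+ coeff (q +ₚ r) k          ≡⟨ coeff-+ₚ p (q +ₚ r) k ⟨
  coeff (p +ₚ (q +ₚ r)) k                 ∎
  where open ≡-Reasoning

+ₚ-identityʳ : ∀ p → p +ₚ [] ≈ p
+ₚ-identityʳ p = mk≈ λ k → trans (coeff-+ₚ p [] k) (ℤP.+-identityʳ (coeff p k))

negₚ-cong : ∀ {p q} → p ≈ q → negₚ p ≈ negₚ q
negₚ-cong {p} {q} e = mk≈ λ k → trans (coeff-negₚ p k) (trans (cong ℤ.-_ (at e k)) (sym (coeff-negₚ q k)))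

+ₚ-inverseˡ : ∀ p → negₚ p +ₚ p ≈ []
+ₚ-inverseˡ p = mk≈ λ k →
  trans (coeff-+ₚ (negₚ p) p k) (trans (cong (ℤ._+ coeff p k) (coeff-negₚ p k)) (ℤP.+-inverseˡ (coeff p k)))

+ₚ-inverseʳ : ∀ p → p +ₚ negₚ p ≈ []
+ₚ-inverseʳ p = ≈-trans (+ₚ-comm p (negₚ p)) (+ₚ-inverseˡ p)

*ₚ-cong : ∀ {p p′ q q′} → p ≈ p′ → q ≈ q′ → p *ₚ q ≈ p′ *ₚ q′
*ₚ-cong {p} {p′} {q} {q′} e f = mk≈ λ k →
  trans (coeff-*ₚ p q k) (trans (conv-cong (at e) (at f) k) (sym (coeff-*ₚ p′ q′ k)))

*ₚ-comm : ∀ p q → p *ₚ q ≈ q *ₚ p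
*ₚ-comm p q = mk≈ λ k →
  trans (coeff-*ₚ p q k) (trans (conv-comm (coeff p) (coeff q) k) (sym (coeff-*ₚ q p k)))

*ₚ-assoc : ∀ p q r → (p *ₚ q) *ₚ r ≈ p *ₚ (q *ₚ r)
*ₚ-assoc p q r = mk≈ λ k → begin
  coeff ((p *ₚ q) *ₚ r) k                     ≡⟨ coeff-*ₚ (p *ₚ q) r k ⟩
  conv (coeff (p *ₚ q)) (coeff r) k           ≡⟨ conv-cong (coeff-*ₚ p q) (λ _ → refl) k ⟩
  conv (conv (coeff p) (coeff q)) (coeff r) k ≡⟨ conv-assoc (coeff p) (coeff q) (coeff r) k ⟩
  conv (coeff p) (conv (coeff q) (coeff r)) k ≡⟨ conv-cong (λ _ → refl) (coeff-*ₚ q r) k ⟨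
  conv (coeff p) (coeff (q *ₚ r)) k           ≡⟨ coeff-*ₚ p (q *ₚ r) k ⟨
  coeff (p *ₚ (q *ₚ r)) k                     ∎
  where open ≡-Reasoning

*ₚ-distribʳ : ∀ r p q → (p +ₚ q) *ₚ r ≈ p *ₚ r +ₚ q *ₚ r
*ₚ-distribʳ r p q = mk≈ λ k → begin
  coeff ((p +ₚ q) *ₚ r) k                                   ≡⟨ coeff-*ₚ (p +ₚ q) r k ⟩
  conv (coeff (p +ₚ q)) (coeff r) k                         ≡⟨ conv-cong (coeff-+ₚ p q) (λ _ → refl) k ⟩
  conv (λ j → coeff p j ℤ.+ coeff q j) (coeff r) k          ≡⟨ conv-distribʳ (coeff p) (coeff q) (coeff r) k ⟩
  conv (coeff p) (coeff r) k ℤ.+ conv (coeff q) (coeff r) k ≡⟨ cong₂ ℤ._+_ (coeff-*ₚ p r k) (coeff-*ₚ q r k) ⟨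
  coeff (p *ₚ r) k ℤ.+ coeff (q *ₚ r) k                     ≡⟨ coeff-+ₚ (p *ₚ r) (q *ₚ r) k ⟨
  coeff (p *ₚ r +ₚ q *ₚ r) k                                ∎
  where open ≡-Reasoning

*ₚ-distribˡ : ∀ r p q → r *ₚ (p +ₚ q) ≈ r *ₚ p +ₚ r *ₚ q
*ₚ-distribˡ r p q =
  ≈-trans (*ₚ-comm r (p +ₚ q)) (≈-trans (*ₚ-distribʳ r p q) (+ₚ-cong (*ₚ-comm p r) (*ₚ-comm q r)))

*ₚ-identityˡ : ∀ p → 1ₚ *ₚ p ≈ p
*ₚ-identityˡ p = mk≈ λ k → trans (coeff-*ₚ 1ₚ p k) (conv-oneˡ (coeff p) k)

*ₚ-identityʳ : ∀ p → p *ₚ 1ₚ ≈ p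
*ₚ-identityʳ p = ≈-trans (*ₚ-comm p 1ₚ) (*ₚ-identityˡ p)

ℤ[x] : CommutativeRing _ _
ℤ[x] = record
  { Carrier = Poly ; _≈_ = _≈_ ; _+_ = _+ₚ_ ; _*_ = _*ₚ_ ; -_ = negₚ ; 0# = [] ; 1# = 1ₚ
  ; isCommutativeRing = record
    { isRing = record
      { +-isAbelianGroup = record
        { isGroup = record
          { isMonoid = record
            { isSemigroup = record
              { isMagma = record
                { isEquivalence = record { refl = ≈-refl ; sym = ≈-sym ; trans = ≈-trans }
                ; ∙-cong = +ₚ-cong }
              ; assoc = +ₚ-assoc }
            ; identity = (λ _ → ≈-refl) , +ₚ-identityʳ }
          ; inverse = +ₚ-inverseˡ , +ₚ-inverseʳ
          ; ⁻¹-cong = negₚ-cong }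
        ; comm = +ₚ-comm }
      ; *-cong = *ₚ-cong
      ; *-assoc = *ₚ-assoc
      ; *-identity = *ₚ-identityˡ , *ₚ-identityʳ
      ; distrib = *ₚ-distribˡ , *ₚ-distribʳ }
    ; *-comm = *ₚ-comm } }

≈-setoid : Setoid _ _
≈-setoid = CommutativeRing.setoid ℤ[x]

-- The ring solver only needs a sound (not complete) zero test.
isZero : (p : Poly) → Maybe ([] ≈ p)
isZero []      = just ≈-refl
isZero (a ∷ p) with a ℤ.≟ 0ℤ | isZero p
... | yes refl | just e = just (mk≈ λ { zero → refl ; (suc k) → at e k })
... | _        | _      = nothing

open import Tactic.RingSolver.NonReflective (fromCommutativeRing ℤ[x] isZero)
  using (solve; _⊜_; Κ; _⊕_; _⊗_; ⊝_)

-- Degree bounds, monic polynomials and division with remainder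

Vanishes : ℕ → (ℕ → ℤ) → Set
Vanishes K f = ∀ j → K ≤ j → f j ≡ 0ℤ

DegBelow : ℕ → Poly → Set
DegBelow K p = Vanishes K (coeff p)

Monic : ℕ → Poly → Set
Monic D p = (coeff p D ≡ 1ℤ) × DegBelow (suc D) p

infix 4 _∣ₚ_
_∣ₚ_ : Poly → Poly → Set
a ∣ₚ b = Σ Poly λ q → q *ₚ a ≈ b

DegBelow-cong : ∀ {K p q} → p ≈ q → DegBelow K p → DegBelow K q
DegBelow-cong e z j le = trans (sym (at e j)) (z j le)

Monic-cong : ∀ {D p q} → p ≈ q → Monic D p → Monic D q
Monic-cong e (top , z) = trans (sym (at e _)) top , DegBelow-cong e z

conv-vanishesˡ : ∀ f g → Vanishes 0 f → ∀ n → conv f g n ≡ 0ℤ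
conv-vanishesˡ f g z n = trans (conv-cong (λ k → z k z≤n) (λ _ → refl) n) (conv-zeroˡ g n)

conv-vanishes : ∀ a b f g → Vanishes (suc a) f → Vanishes (suc b) g →
                Vanishes (suc (a + b)) (conv f g)
conv-vanishes zero b f g zf zg (suc n) (s≤s le) =
  cong₂ ℤ._+_ (trans (cong (f 0 ℤ.*_) (zg (suc n) (s≤s le))) (ℤP.*-zeroʳ (f 0)))
              (conv-vanishesˡ (f ∘ suc) g (λ j _ → zf (suc j) (s≤s z≤n)) n)
conv-vanishes (suc a) b f g zf zg (suc n) (s≤s le) =
  cong₂ ℤ._+_ (trans (cong (f 0 ℤ.*_) (zg (suc n) (s≤s (ℕP.≤-trans (ℕP.m≤n+m b a) (ℕP.≤-trans (ℕP.n≤1+n _) le)))))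
                     (ℤP.*-zeroʳ (f 0)))
              (conv-vanishes a b (f ∘ suc) g (λ j le′ → zf (suc j) (s≤s le′)) zg n le)

conv-top : ∀ a b f g → Vanishes (suc a) f → Vanishes (suc b) g → conv f g (a + b) ≡ f a ℤ.* g b
conv-top zero zero f g zf zg = refl
conv-top zero (suc b) f g zf zg =
  trans (cong (λ z → f 0 ℤ.* g (suc b) ℤ.+ z) (conv-vanishesˡ (f ∘ suc) g (λ j _ → zf (suc j) (s≤s z≤n)) b))
        (ℤP.+-identityʳ _)
conv-top (suc a) b f g zf zg =
  trans (cong₂ ℤ._+_ (trans (cong (f 0 ℤ.*_) (zg (suc (a + b)) (s≤s (ℕP.m≤n+m b a)))) (ℤP.*-zeroʳ (f 0)))
                     (conv-top a b (f ∘ suc) g (λ j le → zf (suc j) (s≤s le)) zg))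
        (ℤP.+-identityˡ _)

DegBelow-*ₚ : ∀ a b p q → DegBelow (suc a) p → DegBelow (suc b) q → DegBelow (suc (a + b)) (p *ₚ q)
DegBelow-*ₚ a b p q zp zq j le = trans (coeff-*ₚ p q j) (conv-vanishes a b (coeff p) (coeff q) zp zq j le)

coeff-*ₚ-top : ∀ a b p q → DegBelow (suc a) p → DegBelow (suc b) q →
               coeff (p *ₚ q) (a + b) ≡ coeff p a ℤ.* coeff q b
coeff-*ₚ-top a b p q zp zq = trans (coeff-*ₚ p q (a + b)) (conv-top a b (coeff p) (coeff q) zp zq)

Monic-*ₚ : ∀ {a b p q} → Monic a p → Monic b q → Monic (a + b) (p *ₚ q)
Monic-*ₚ {a} {b} {p} {q} (tp , zp) (tq , zq) =
  trans (coeff-*ₚ-top a b p q zp zq) (cong₂ ℤ._*_ tp tq) , DegBelow-*ₚ a b p q zp zq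

coeff-∷-*ₚ-zero : ∀ z p q → coeff ((z ∷ p) *ₚ q) 0 ≡ z ℤ.* coeff q 0
coeff-∷-*ₚ-zero z p q =
  trans (coeff-+ₚ (scale z q) (0ℤ ∷ (p *ₚ q)) 0) (trans (ℤP.+-identityʳ _) (coeff-scale z q 0))

coeff-∷-*ₚ-suc : ∀ z p q j → coeff ((z ∷ p) *ₚ q) (suc j) ≡ z ℤ.* coeff q (suc j) ℤ.+ coeff (p *ₚ q) j
coeff-∷-*ₚ-suc z p q j =
  trans (coeff-+ₚ (scale z q) (0ℤ ∷ (p *ₚ q)) (suc j)) (cong (ℤ._+ coeff (p *ₚ q) j) (coeff-scale z q (suc j)))

coeff-const-*ₚ : ∀ c p k → coeff (const c *ₚ p) k ≡ c ℤ.* coeff p k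
coeff-const-*ₚ c p zero    = coeff-∷-*ₚ-zero c [] p
coeff-const-*ₚ c p (suc k) = trans (coeff-∷-*ₚ-suc c [] p k) (ℤP.+-identityʳ _)

scale≈const-*ₚ : ∀ c p → scale c p ≈ const c *ₚ p
scale≈const-*ₚ c p = mk≈ λ k → trans (coeff-scale c p k) (sym (coeff-const-*ₚ c p k))

DegBelow-*ₚ-monic⁻¹ : ∀ {D p} → Monic D p → ∀ r e → DegBelow (D + e) (r *ₚ p) → DegBelow e r
DegBelow-*ₚ-monic⁻¹ mp [] e _ j _ = refl
DegBelow-*ₚ-monic⁻¹ {D} {p} mp@(tp , zp) (z ∷ r) zero zrp = λ
  { zero _ → z≡0 ; (suc j) _ → zr j z≤n }
  where
  shift : ∀ j → D ≤ j → coeff ((z ∷ r) *ₚ p) (suc j) ≡ coeff (r *ₚ p) j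
  shift j le = trans (coeff-∷-*ₚ-suc z r p j)
    (trans (cong (ℤ._+ coeff (r *ₚ p) j) (trans (cong (z ℤ.*_) (zp (suc j) (s≤s le))) (ℤP.*-zeroʳ z)))
           (ℤP.+-identityˡ _))
  zr : DegBelow 0 r
  zr = DegBelow-*ₚ-monic⁻¹ mp r 0 λ j le →
    trans (sym (shift j (ℕP.≤-trans (ℕP.m≤m+n D 0) le))) (zrp (suc j) (ℕP.m≤n⇒m≤1+n le))
  z≡0 : z ≡ 0ℤ
  z≡0 = begin
    z                      ≡⟨ sym (ℤP.*-identityʳ z) ⟩
    z ℤ.* 1ℤ               ≡⟨ cong (z ℤ.*_) tp ⟨
    z ℤ.* coeff p D        ≡⟨ coeff-const-*ₚ z p D ⟨
    coeff (const z *ₚ p) D ≡⟨ at (*ₚ-cong {z ∷ r} {const z} {p} (∷-cong refl (mk≈ λ j → zr j z≤n)) ≈-refl) D ⟨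
    coeff ((z ∷ r) *ₚ p) D ≡⟨ zrp D (ℕP.≤-reflexive (ℕP.+-identityʳ D)) ⟩
    0ℤ                     ∎
    where open ≡-Reasoning
DegBelow-*ₚ-monic⁻¹ {D} {p} mp@(tp , zp) (z ∷ r) (suc e) zrp = λ
  { (suc j) (s≤s le) → DegBelow-*ₚ-monic⁻¹ mp r e zr j le }
  where
  zr : DegBelow (D + e) (r *ₚ p)
  zr j le = begin
    coeff (r *ₚ p) j                           ≡⟨ ℤP.+-identityˡ _ ⟨
    0ℤ ℤ.+ coeff (r *ₚ p) j                    ≡⟨ cong (ℤ._+ coeff (r *ₚ p) j) z*p≡0 ⟨
    z ℤ.* coeff p (suc j) ℤ.+ coeff (r *ₚ p) j ≡⟨ coeff-∷-*ₚ-suc z r p j ⟨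
    coeff ((z ∷ r) *ₚ p) (suc j)               ≡⟨ zrp (suc j) (ℕP.≤-trans (ℕP.≤-reflexive (ℕP.+-suc D e)) (s≤s le)) ⟩
    0ℤ                                         ∎
    where
    open ≡-Reasoning
    z*p≡0 : z ℤ.* coeff p (suc j) ≡ 0ℤ
    z*p≡0 = trans (cong (z ℤ.*_) (zp (suc j) (s≤s (ℕP.≤-trans (ℕP.m≤m+n D e) le)))) (ℤP.*-zeroʳ z)

DegBelow-*ₚ-monic⇒≈[] : ∀ {D p} → Monic D p → ∀ r → DegBelow D (r *ₚ p) → r ≈ []
DegBelow-*ₚ-monic⇒≈[] {D} mp r z =
  mk≈ λ k → DegBelow-*ₚ-monic⁻¹ mp r 0 (λ j le → z j (ℕP.≤-trans (ℕP.m≤m+n D 0) le)) k z≤n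

*ₚ-cancelʳ-monic : ∀ {D a} → Monic D a → ∀ p q → p *ₚ a ≈ q *ₚ a → p ≈ q
*ₚ-cancelʳ-monic {D} {a} ma p q e = mk≈ λ k →
  ℤP.i-j≡0⇒i≡j _ _ (trans (sym (coeff--ₚ p q k)) (at (DegBelow-*ₚ-monic⇒≈[] ma (p -ₚ q) λ j _ → at difference j) k))
  where
  difference : (p -ₚ q) *ₚ a ≈ []
  difference = ≈-trans (solve 3 (λ p q a → ((p ⊕ (⊝ q)) ⊗ a) ⊜ ((p ⊗ a) ⊕ (⊝ (q ⊗ a)))) ≈-refl p q a)
                       (≈-trans (+ₚ-cong e ≈-refl) (+ₚ-inverseʳ (q *ₚ a)))

Monic-quotient : ∀ {E N q m t} → Monic E q → Monic N m → E ≤ N → t *ₚ q ≈ m → Monic (N ∸ E) t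
Monic-quotient {E} {N} {q} {m} {t} mq (tm , zm) E≤N e = top , vanish
  where
  E+[1+N-E]≡1+N : E + suc (N ∸ E) ≡ suc N
  E+[1+N-E]≡1+N = trans (ℕP.+-suc E (N ∸ E)) (cong suc (ℕP.m+[n∸m]≡n E≤N))
  vanish : DegBelow (suc (N ∸ E)) t
  vanish = DegBelow-*ₚ-monic⁻¹ mq t (suc (N ∸ E)) λ j le →
    DegBelow-cong (≈-sym e) zm j (ℕP.≤-trans (ℕP.≤-reflexive (sym E+[1+N-E]≡1+N)) le)
  top : coeff t (N ∸ E) ≡ 1ℤ
  top = begin
    coeff t (N ∸ E)               ≡⟨ ℤP.*-identityʳ _ ⟨
    coeff t (N ∸ E) ℤ.* 1ℤ        ≡⟨ cong (coeff t (N ∸ E) ℤ.*_) (proj₁ mq) ⟨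
    coeff t (N ∸ E) ℤ.* coeff q E ≡⟨ coeff-*ₚ-top (N ∸ E) E t q vanish (proj₂ mq) ⟨
    coeff (t *ₚ q) (N ∸ E + E)    ≡⟨ cong (coeff (t *ₚ q)) (ℕP.m∸n+n≡m E≤N) ⟩
    coeff (t *ₚ q) N              ≡⟨ at e N ⟩
    coeff m N                     ≡⟨ tm ⟩
    1ℤ                            ∎
    where open ≡-Reasoning

divMod-monic : ∀ {D a} → Monic D a → ∀ c → Σ Poly λ q → Σ Poly λ r → (c ≈ q *ₚ a +ₚ r) × DegBelow D r
divMod-monic ma [] = [] , [] , ≈-refl , λ _ _ → refl
divMod-monic {D} {a} ma@(ta , za) (c₀ ∷ c) with divMod-monic ma c
... | q , r , c≈ , zr = t ∷ q , r′ , c₀∷c≈ , zr′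
  where
  t : ℤ
  t = coeff (c₀ ∷ r) D
  r′ : Poly
  r′ = (c₀ ∷ r) -ₚ scale t a
  coeff-r′ : ∀ j → coeff r′ j ≡ coeff (c₀ ∷ r) j ℤ.- t ℤ.* coeff a j
  coeff-r′ j = trans (coeff--ₚ (c₀ ∷ r) (scale t a) j) (cong (λ w → coeff (c₀ ∷ r) j ℤ.- w) (coeff-scale t a j))
  c₀∷c≈ : c₀ ∷ c ≈ (t ∷ q) *ₚ a +ₚ r′
  c₀∷c≈ = mk≈ λ
    { zero → sym (trans (coeff-+ₚ ((t ∷ q) *ₚ a) r′ 0)
                  (trans (cong₂ ℤ._+_ (coeff-∷-*ₚ-zero t q a) (coeff-r′ 0)) (cancel₀ c₀ (t ℤ.* coeff a 0))))
    ; (suc k) → sym (trans (coeff-+ₚ ((t ∷ q) *ₚ a) r′ (suc k))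
                  (trans (cong₂ ℤ._+_ (coeff-∷-*ₚ-suc t q a k) (coeff-r′ (suc k)))
                  (trans (cancel (t ℤ.* coeff a (suc k)) (coeff (q *ₚ a) k) (coeff r k))
                         (sym (trans (at c≈ k) (coeff-+ₚ (q *ₚ a) r k))))))
    }
    where
    cancel₀ : ∀ x y → y ℤ.+ (x ℤ.- y) ≡ x
    cancel₀ = solve-∀
    cancel : ∀ x y z → x ℤ.+ y ℤ.+ (z ℤ.- x) ≡ y ℤ.+ z
    cancel = solve-∀
  zr′ : DegBelow D r′
  zr′ j le with ℕP.m≤n⇒m<n∨m≡n le
  ... | inj₂ refl = trans (coeff-r′ D)
    (trans (cong (λ w → t ℤ.- t ℤ.* w) ta) (trans (cong (λ x → t ℤ.- x) (ℤP.*-identityʳ t)) (ℤP.+-inverseʳ t)))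
  ... | inj₁ D<j = trans (coeff-r′ j) (above j D<j)
    where
    above : ∀ j → D < j → coeff (c₀ ∷ r) j ℤ.- t ℤ.* coeff a j ≡ 0ℤ
    above (suc j) (s≤s D≤j) =
      trans (cong₂ (λ x y → x ℤ.- t ℤ.* y) (zr j D≤j) (za (suc j) (s≤s D≤j))) (cong (λ x → 0ℤ ℤ.- x) (ℤP.*-zeroʳ t))

∣ₚ-cancel-const : ∀ {D m} → Monic D m → ∀ {c} → c ≢ 0ℤ → ∀ p → m ∣ₚ const c *ₚ p → m ∣ₚ p
∣ₚ-cancel-const {D} {m} mm {c} c≢0 p (u , u*m≈cp) with divMod-monic mm p
... | q , r , p≈ , zr = q , ≈-sym (≈-trans p≈ (≈-trans (+ₚ-cong ≈-refl r≈0) (+ₚ-identityʳ _)))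
  where
  w : Poly
  w = u -ₚ const c *ₚ q
  w*m≈cr : w *ₚ m ≈ const c *ₚ r
  w*m≈cr = begin
    w *ₚ m
      ≈⟨ solve 4 (λ u m c q → ((u ⊕ (⊝ (c ⊗ q))) ⊗ m) ⊜ ((u ⊗ m) ⊕ (⊝ (c ⊗ (q ⊗ m))))) ≈-refl u m (const c) q ⟩
    u *ₚ m -ₚ const c *ₚ (q *ₚ m)
      ≈⟨ +ₚ-cong (≈-trans u*m≈cp (*ₚ-cong (≈-refl {const c}) p≈)) ≈-refl ⟩
    const c *ₚ (q *ₚ m +ₚ r) -ₚ const c *ₚ (q *ₚ m)
      ≈⟨ solve 4 (λ c q m r → ((c ⊗ ((q ⊗ m) ⊕ r)) ⊕ (⊝ (c ⊗ (q ⊗ m)))) ⊜ (c ⊗ r)) ≈-refl (const c) q m r ⟩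
    const c *ₚ r ∎
    where open SetoidReasoning ≈-setoid
  w≈0 : w ≈ []
  w≈0 = DegBelow-*ₚ-monic⇒≈[] mm w λ j le →
    trans (at w*m≈cr j) (trans (coeff-const-*ₚ c r j) (trans (cong (c ℤ.*_) (zr j le)) (ℤP.*-zeroʳ c)))
  r≈0 : r ≈ []
  r≈0 = mk≈ λ k → [ ⊥-elim ∘ c≢0 , id ]′ (ℤP.i*j≡0⇒i≡0∨j≡0 c (begin
    c ℤ.* coeff r k        ≡⟨ coeff-const-*ₚ c r k ⟨
    coeff (const c *ₚ r) k ≡⟨ at w*m≈cr k ⟨
    coeff (w *ₚ m) k       ≡⟨ at (*ₚ-cong w≈0 (≈-refl {m})) k ⟩
    0ℤ                     ∎))
    where open ≡-Reasoning

-- The polynomials xⁿ - 1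

xⁿ : ℕ → Poly
xⁿ n = replicate0 n ++ (1ℤ ∷ [])

coeff-replicate0-++ˡ : ∀ k p i → i < k → coeff (replicate0 k ++ p) i ≡ 0ℤ
coeff-replicate0-++ˡ (suc k) p zero    _         = refl
coeff-replicate0-++ˡ (suc k) p (suc i) (s≤s i<k) = coeff-replicate0-++ˡ k p i i<k

coeff-replicate0-++ʳ : ∀ k p i → coeff (replicate0 k ++ p) (k + i) ≡ coeff p i
coeff-replicate0-++ʳ zero    p i = refl
coeff-replicate0-++ʳ (suc k) p i = coeff-replicate0-++ʳ k p i

replicate0-++-cong : ∀ k {p q} → p ≈ q → replicate0 k ++ p ≈ replicate0 k ++ q
replicate0-++-cong zero    e = e
replicate0-++-cong (suc k) e = ∷-cong refl (replicate0-++-cong k e)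

0∷-*ₚ : ∀ p q → (0ℤ ∷ p) *ₚ q ≈ 0ℤ ∷ (p *ₚ q)
0∷-*ₚ p q = mk≈ λ
  { zero    → trans (coeff-∷-*ₚ-zero 0ℤ p q) (ℤP.*-zeroˡ (coeff q 0))
  ; (suc k) → trans (coeff-∷-*ₚ-suc 0ℤ p q k)
                    (trans (cong (ℤ._+ coeff (p *ₚ q) k) (ℤP.*-zeroˡ (coeff q (suc k)))) (ℤP.+-identityˡ _))
  }

xⁿ-*ₚ : ∀ n p → xⁿ n *ₚ p ≈ replicate0 n ++ p
xⁿ-*ₚ zero    p = *ₚ-identityˡ p
xⁿ-*ₚ (suc n) p = ≈-trans (0∷-*ₚ (xⁿ n) p) (∷-cong refl (xⁿ-*ₚ n p))

replicate0-+-++ : ∀ a b p → replicate0 (a + b) ++ p ≡ replicate0 a ++ (replicate0 b ++ p)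
replicate0-+-++ zero    b p = refl
replicate0-+-++ (suc a) b p = cong (0ℤ ∷_) (replicate0-+-++ a b p)

xⁿ-+ : ∀ a b → xⁿ (a + b) ≈ xⁿ a *ₚ xⁿ b
xⁿ-+ a b = ≈-trans (≈-reflexive (replicate0-+-++ a b (1ℤ ∷ []))) (≈-sym (xⁿ-*ₚ a (xⁿ b)))

xⁿ-1≈xⁿ-1ₚ : ∀ n → xⁿ-1 n ≈ xⁿ n -ₚ 1ₚ
xⁿ-1≈xⁿ-1ₚ zero    = mk≈ λ { zero → refl ; (suc k) → refl }
xⁿ-1≈xⁿ-1ₚ (suc n) = mk≈ λ
  { zero    → sym (coeff--ₚ (xⁿ (suc n)) 1ₚ 0)
  ; (suc k) → sym (trans (coeff--ₚ (xⁿ (suc n)) 1ₚ (suc k)) (ℤP.+-identityʳ _))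
  }

Monic-xⁿ-1 : ∀ n → 1 ≤ n → Monic n (xⁿ-1 n)
Monic-xⁿ-1 (suc n) _ = top n , λ { (suc j) (s≤s n≤j) → above n j n≤j }
  where
  top : ∀ n → coeff (xⁿ n) n ≡ 1ℤ
  top zero    = refl
  top (suc n) = top n
  above : ∀ n j → n < j → coeff (xⁿ n) j ≡ 0ℤ
  above zero    (suc j) _         = refl
  above (suc n) (suc j) (s≤s n<j) = above n j n<j

xⁿ-1-+ : ∀ a b → xⁿ-1 (a + b) ≈ xⁿ a *ₚ xⁿ-1 b +ₚ xⁿ-1 a
xⁿ-1-+ a b = begin
  xⁿ-1 (a + b)             ≈⟨ xⁿ-1≈xⁿ-1ₚ (a + b) ⟩
  xⁿ (a + b) -ₚ 1ₚ         ≈⟨ +ₚ-cong (xⁿ-+ a b) ≈-refl ⟩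
  xⁿ a *ₚ xⁿ b -ₚ 1ₚ
    ≈⟨ solve 2 (λ xa xb → ((xa ⊗ xb) ⊕ (⊝ Κ 1ₚ)) ⊜ ((xa ⊗ (xb ⊕ (⊝ Κ 1ₚ))) ⊕ (xa ⊕ (⊝ Κ 1ₚ)))) ≈-refl (xⁿ a) (xⁿ b) ⟩
  xⁿ a *ₚ (xⁿ b -ₚ 1ₚ) +ₚ (xⁿ a -ₚ 1ₚ)
    ≈⟨ +ₚ-cong (*ₚ-cong (≈-refl {xⁿ a}) (≈-sym (xⁿ-1≈xⁿ-1ₚ b))) (≈-sym (xⁿ-1≈xⁿ-1ₚ a)) ⟩
  xⁿ a *ₚ xⁿ-1 b +ₚ xⁿ-1 a ∎
  where open SetoidReasoning ≈-setoid

geometric : ℕ → ℕ → Poly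
geometric g zero    = []
geometric g (suc k) = 1ₚ +ₚ xⁿ g *ₚ geometric g k

geometric-*ₚ-xⁿ-1 : ∀ g k → geometric g k *ₚ xⁿ-1 g ≈ xⁿ-1 (k * g)
geometric-*ₚ-xⁿ-1 g zero    = ≈-refl
geometric-*ₚ-xⁿ-1 g (suc k) = begin
  (1ₚ +ₚ xⁿ g *ₚ G) *ₚ xⁿ-1 g
    ≈⟨ solve 3 (λ m G x → ((Κ 1ₚ ⊕ (m ⊗ G)) ⊗ x) ⊜ ((m ⊗ (G ⊗ x)) ⊕ x)) ≈-refl (xⁿ g) G (xⁿ-1 g) ⟩
  xⁿ g *ₚ (G *ₚ xⁿ-1 g) +ₚ xⁿ-1 g ≈⟨ +ₚ-cong (*ₚ-cong (≈-refl {xⁿ g}) (geometric-*ₚ-xⁿ-1 g k)) ≈-refl ⟩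
  xⁿ g *ₚ xⁿ-1 (k * g) +ₚ xⁿ-1 g  ≈⟨ xⁿ-1-+ g (k * g) ⟨
  xⁿ-1 (g + k * g)                ∎
  where
  open SetoidReasoning ≈-setoid
  G = geometric g k

geometric-mod-xⁿ-1 : ∀ g k → Σ Poly λ w → geometric g k ≈ const (ℤ.+ k) +ₚ w *ₚ xⁿ-1 g
geometric-mod-xⁿ-1 g zero    = [] , mk≈ λ { zero → refl ; (suc j) → refl }
geometric-mod-xⁿ-1 g (suc k) with geometric-mod-xⁿ-1 g k
... | w , G≈ = const (ℤ.+ k) +ₚ xⁿ g *ₚ w , (begin
  1ₚ +ₚ xⁿ g *ₚ geometric g k
    ≈⟨ +ₚ-cong ≈-refl (*ₚ-cong xᵍ≈X+1 G≈) ⟩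
  1ₚ +ₚ (X +ₚ 1ₚ) *ₚ (const (ℤ.+ k) +ₚ w *ₚ X)
    ≈⟨ solve 3 (λ x K w → (Κ 1ₚ ⊕ ((x ⊕ Κ 1ₚ) ⊗ (K ⊕ (w ⊗ x)))) ⊜ ((Κ 1ₚ ⊕ K) ⊕ ((K ⊕ ((x ⊕ Κ 1ₚ) ⊗ w)) ⊗ x)))
             ≈-refl X (const (ℤ.+ k)) w ⟩
  (1ₚ +ₚ const (ℤ.+ k)) +ₚ (const (ℤ.+ k) +ₚ (X +ₚ 1ₚ) *ₚ w) *ₚ X
    ≈⟨ +ₚ-cong (mk≈ λ { zero → refl ; (suc j) → refl })
               (*ₚ-cong (+ₚ-cong (≈-refl {const (ℤ.+ k)}) (*ₚ-cong (≈-sym xᵍ≈X+1) (≈-refl {w}))) (≈-refl {X})) ⟩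
  const (ℤ.+ suc k) +ₚ (const (ℤ.+ k) +ₚ xⁿ g *ₚ w) *ₚ X ∎)
  where
  open SetoidReasoning ≈-setoid
  X = xⁿ-1 g
  xᵍ≈X+1 : xⁿ g ≈ X +ₚ 1ₚ
  xᵍ≈X+1 = ≈-trans (solve 1 (λ m → m ⊜ ((m ⊕ (⊝ Κ 1ₚ)) ⊕ Κ 1ₚ)) ≈-refl (xⁿ g)) (+ₚ-cong (≈-sym (xⁿ-1≈xⁿ-1ₚ g)) ≈-refl)

xⁿ-1-∣ : ∀ {d n} → d ∣ n → xⁿ-1 d ∣ₚ xⁿ-1 n
xⁿ-1-∣ {d} (divides k refl) = geometric d k , geometric-*ₚ-xⁿ-1 d k

private
  bezout-from : ∀ g a b x y → g + y * b ≡ x * a →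
                Σ Poly λ u → Σ Poly λ v → u *ₚ xⁿ-1 a +ₚ v *ₚ xⁿ-1 b ≈ xⁿ-1 g
  bezout-from g a b x y eq = geometric a x , negₚ (xⁿ g *ₚ geometric b y) , (begin
    geometric a x *ₚ xⁿ-1 a +ₚ negₚ (xⁿ g *ₚ geometric b y) *ₚ xⁿ-1 b
      ≈⟨ solve 4 (λ A m q X → (A ⊕ ((⊝ (m ⊗ q)) ⊗ X)) ⊜ (A ⊕ (⊝ (m ⊗ (q ⊗ X)))))
               ≈-refl (geometric a x *ₚ xⁿ-1 a) (xⁿ g) (geometric b y) (xⁿ-1 b) ⟩
    geometric a x *ₚ xⁿ-1 a -ₚ xⁿ g *ₚ (geometric b y *ₚ xⁿ-1 b)
      ≈⟨ +ₚ-cong (geometric-*ₚ-xⁿ-1 a x) (negₚ-cong (*ₚ-cong (≈-refl {xⁿ g}) (geometric-*ₚ-xⁿ-1 b y))) ⟩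
    xⁿ-1 (x * a) -ₚ xⁿ g *ₚ xⁿ-1 (y * b)
      ≈⟨ +ₚ-cong (≈-trans (≈-reflexive (cong xⁿ-1 (sym eq))) (xⁿ-1-+ g (y * b))) ≈-refl ⟩
    xⁿ g *ₚ xⁿ-1 (y * b) +ₚ xⁿ-1 g -ₚ xⁿ g *ₚ xⁿ-1 (y * b)
      ≈⟨ solve 2 (λ A B → ((A ⊕ B) ⊕ (⊝ A)) ⊜ B) ≈-refl (xⁿ g *ₚ xⁿ-1 (y * b)) (xⁿ-1 g) ⟩
    xⁿ-1 g ∎)
    where open SetoidReasoning ≈-setoid

xⁿ-1-bezout : ∀ a b → Σ Poly λ u → Σ Poly λ v → u *ₚ xⁿ-1 a +ₚ v *ₚ xⁿ-1 b ≈ xⁿ-1 (gcd a b)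
xⁿ-1-bezout a b with Bézout.identity (gcd-GCD a b)
... | Bézout.+- x y eq = bezout-from (gcd a b) a b x y eq
... | Bézout.-+ x y eq with bezout-from (gcd a b) b a y x eq
...   | u , v , e = v , u , ≈-trans (+ₚ-comm (v *ₚ xⁿ-1 a) (u *ₚ xⁿ-1 b)) e

-- Substitution x ↦ xⁿ

-- expand n f = f(xⁿ) for n ≥ 1; expand 0 agrees with expand 1.
expand : ℕ → Poly → Poly
expand n []      = []
expand n (a ∷ f) = a ∷ (replicate0 (n ∸ 1) ++ expand n f)

private
  replicate0-++-≈[] : ∀ k {p} → p ≈ [] → replicate0 k ++ p ≈ []
  replicate0-++-≈[] zero    e = e
  replicate0-++-≈[] (suc k) e = mk≈ λ { zero → refl ; (suc j) → at (replicate0-++-≈[] k e) j }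

  replicate0-++-+ₚ : ∀ k p q → (replicate0 k ++ p) +ₚ (replicate0 k ++ q) ≈ replicate0 k ++ (p +ₚ q)
  replicate0-++-+ₚ zero    p q = ≈-refl
  replicate0-++-+ₚ (suc k) p q = ∷-cong refl (replicate0-++-+ₚ k p q)

  replicate0-++-scale : ∀ c k p → scale c (replicate0 k ++ p) ≈ replicate0 k ++ scale c p
  replicate0-++-scale c zero    p = ≈-refl
  replicate0-++-scale c (suc k) p = ∷-cong (ℤP.*-zeroʳ c) (replicate0-++-scale c k p)

  tail-≈ : ∀ {a b p q} → a ∷ p ≈ b ∷ q → p ≈ q
  tail-≈ e = mk≈ λ k → at e (suc k)

  tail-≈[] : ∀ {a p} → a ∷ p ≈ [] → p ≈ []
  tail-≈[] e = mk≈ λ k → at e (suc k)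

module _ (n : ℕ) where

  expand-≈[] : ∀ {p} → p ≈ [] → expand (suc n) p ≈ []
  expand-≈[] {[]}    e = ≈-refl
  expand-≈[] {a ∷ p} e = mk≈ λ
    { zero → at e 0 ; (suc j) → at (replicate0-++-≈[] n (expand-≈[] (tail-≈[] e))) j }

  expand-cong : ∀ {p q} → p ≈ q → expand (suc n) p ≈ expand (suc n) q
  expand-cong {[]}    {q}     e = ≈-sym (expand-≈[] (≈-sym e))
  expand-cong {a ∷ p} {[]}    e = expand-≈[] e
  expand-cong {a ∷ p} {b ∷ q} e = ∷-cong (at e 0) (replicate0-++-cong n (expand-cong (tail-≈ e)))

  expand-+ₚ : ∀ p q → expand (suc n) (p +ₚ q) ≈ expand (suc n) p +ₚ expand (suc n) q
  expand-+ₚ []      q       = ≈-refl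
  expand-+ₚ (a ∷ p) []      = ≈-sym (+ₚ-identityʳ _)
  expand-+ₚ (a ∷ p) (b ∷ q) = ∷-cong refl
    (≈-trans (replicate0-++-cong n (expand-+ₚ p q)) (≈-sym (replicate0-++-+ₚ n (expand (suc n) p) (expand (suc n) q))))

  expand-scale : ∀ c p → expand (suc n) (scale c p) ≈ scale c (expand (suc n) p)
  expand-scale c []      = ≈-refl
  expand-scale c (a ∷ p) = ∷-cong refl
    (≈-trans (replicate0-++-cong n (expand-scale c p)) (≈-sym (replicate0-++-scale c n (expand (suc n) p))))

  expand-0∷ : ∀ p → expand (suc n) (0ℤ ∷ p) ≈ xⁿ (suc n) *ₚ expand (suc n) p
  expand-0∷ p = ≈-sym (xⁿ-*ₚ (suc n) (expand (suc n) p))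

  expand-*ₚ : ∀ p q → expand (suc n) (p *ₚ q) ≈ expand (suc n) p *ₚ expand (suc n) q
  expand-*ₚ []      q = ≈-refl
  expand-*ₚ (a ∷ p) q = begin
    expand (suc n) (scale a q +ₚ (0ℤ ∷ (p *ₚ q)))
      ≈⟨ expand-+ₚ (scale a q) _ ⟩
    expand (suc n) (scale a q) +ₚ expand (suc n) (0ℤ ∷ (p *ₚ q))
      ≈⟨ +ₚ-cong (≈-trans (expand-scale a q) (scale≈const-*ₚ a q′))
                 (≈-trans (expand-0∷ (p *ₚ q)) (*ₚ-cong (≈-refl {xⁿ (suc n)}) (expand-*ₚ p q))) ⟩
    const a *ₚ q′ +ₚ xⁿ (suc n) *ₚ (p′ *ₚ q′)
      ≈⟨ solve 4 (λ c q m p → ((c ⊗ q) ⊕ (m ⊗ (p ⊗ q))) ⊜ ((c ⊕ (m ⊗ p)) ⊗ q)) ≈-refl (const a) q′ (xⁿ (suc n)) p′ ⟩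
    (const a +ₚ xⁿ (suc n) *ₚ p′) *ₚ q′
      ≈⟨ *ₚ-cong (≈-sym a∷p′≈) ≈-refl ⟩
    expand (suc n) (a ∷ p) *ₚ q′ ∎
    where
    open SetoidReasoning ≈-setoid
    p′ = expand (suc n) p
    q′ = expand (suc n) q
    a∷p′≈ : expand (suc n) (a ∷ p) ≈ const a +ₚ xⁿ (suc n) *ₚ p′
    a∷p′≈ = ≈-trans (mk≈ λ { zero → sym (ℤP.+-identityʳ a) ; (suc k) → refl })
                    (+ₚ-cong (≈-refl {const a}) (expand-0∷ p))

  expand-1ₚ : expand (suc n) 1ₚ ≈ 1ₚ
  expand-1ₚ = mk≈ λ { zero → refl ; (suc k) → at (replicate0-++-≈[] n (≈-refl {[]})) k }

  expand-xⁿ : ∀ m → expand (suc n) (xⁿ m) ≈ xⁿ (m * suc n)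
  expand-xⁿ zero    = expand-1ₚ
  expand-xⁿ (suc m) = ≈-trans (expand-0∷ (xⁿ m))
    (≈-trans (*ₚ-cong (≈-refl {xⁿ (suc n)}) (expand-xⁿ m)) (≈-sym (xⁿ-+ (suc n) (m * suc n))))

  expand-xⁿ-1 : ∀ m → expand (suc n) (xⁿ-1 m) ≈ xⁿ-1 (m * suc n)
  expand-xⁿ-1 m = begin
    expand (suc n) (xⁿ-1 m)          ≈⟨ expand-cong (xⁿ-1≈xⁿ-1ₚ m) ⟩
    expand (suc n) (xⁿ m +ₚ negₚ 1ₚ) ≈⟨ expand-+ₚ (xⁿ m) _ ⟩
    expand (suc n) (xⁿ m) +ₚ expand (suc n) (negₚ 1ₚ)
      ≈⟨ +ₚ-cong (expand-xⁿ m) (≈-trans (expand-scale (ℤ.- 1ℤ) 1ₚ) (negₚ-cong expand-1ₚ)) ⟩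
    xⁿ (m * suc n) -ₚ 1ₚ             ≈⟨ xⁿ-1≈xⁿ-1ₚ (m * suc n) ⟨
    xⁿ-1 (m * suc n)                 ∎
    where open SetoidReasoning ≈-setoid

  coeff-expand-multiple : ∀ p j → coeff (expand (suc n) p) (j * suc n) ≡ coeff p j
  coeff-expand-multiple []      j       = refl
  coeff-expand-multiple (a ∷ p) zero    = refl
  coeff-expand-multiple (a ∷ p) (suc j) =
    trans (coeff-replicate0-++ʳ n (expand (suc n) p) (j * suc n)) (coeff-expand-multiple p j)

  coeff-expand-nonmultiple : ∀ p j r → r < n → coeff (expand (suc n) p) (j * suc n + suc r) ≡ 0ℤ
  coeff-expand-nonmultiple []      j       r r<n = refl
  coeff-expand-nonmultiple (a ∷ p) zero    r r<n = coeff-replicate0-++ˡ n (expand (suc n) p) r r<n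
  coeff-expand-nonmultiple (a ∷ p) (suc j) r r<n =
    trans (cong (coeff (replicate0 n ++ expand (suc n) p)) (ℕP.+-assoc n (j * suc n) (suc r)))
      (trans (coeff-replicate0-++ʳ n (expand (suc n) p) (j * suc n + suc r)) (coeff-expand-nonmultiple p j r r<n))

  DegBelow-expand : ∀ d p → DegBelow (suc d) p → DegBelow (suc (d * suc n)) (expand (suc n) p)
  DegBelow-expand d []      z j le = refl
  DegBelow-expand zero (a ∷ p) z (suc j) le =
    at (replicate0-++-≈[] n (expand-≈[] (mk≈ λ k → z (suc k) (s≤s z≤n)))) j
  DegBelow-expand (suc d) (a ∷ p) z (suc j) (s≤s le) =
    trans (cong (coeff (replicate0 n ++ expand (suc n) p)) (sym (ℕP.m+[n∸m]≡n n≤j)))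
      (trans (coeff-replicate0-++ʳ n (expand (suc n) p) (j ∸ n))
             (DegBelow-expand d p (λ k le′ → z (suc k) (s≤s le′)) (j ∸ n) bound))
    where
    n≤j : n ≤ j
    n≤j = ℕP.≤-trans (ℕP.m≤m+n n _) (ℕP.≤-trans (ℕP.n≤1+n _) le)
    bound : suc (d * suc n) ≤ j ∸ n
    bound = ℕP.≤-trans (ℕP.≤-reflexive (sym (ℕP.m+n∸m≡n n (suc (d * suc n)))))
                       (ℕP.∸-monoˡ-≤ n (ℕP.≤-trans (ℕP.≤-reflexive (ℕP.+-suc n (d * suc n))) le))

  Monic-expand : ∀ {d p} → Monic d p → Monic (d * suc n) (expand (suc n) p)
  Monic-expand {d} {p} (top , z) = trans (coeff-expand-multiple p d) top , DegBelow-expand d p z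

-- Counting, Euler's totient and Σ_{d ∣ n} φ(d) = n

oneTo : ℕ → List ℕ
oneTo zero    = []
oneTo (suc n) = oneTo n ++ [ suc n ]

map-suc-upTo : ∀ n → map suc (upTo n) ≡ oneTo n
map-suc-upTo zero    = refl
map-suc-upTo (suc n) = trans (cong (map suc) (sym (LP.upTo-∷ʳ n)))
  (trans (LP.map-++ suc (upTo n) [ n ]) (cong (_++ [ suc n ]) (map-suc-upTo n)))

length-oneTo : ∀ n → length (oneTo n) ≡ n
length-oneTo zero    = refl
length-oneTo (suc n) = trans (LP.length-++ (oneTo n)) (trans (cong (_+ 1) (length-oneTo n)) (ℕP.+-comm n 1))

oneTo-+ : ∀ a b → oneTo (a + b) ≡ oneTo a ++ map (a +_) (oneTo b)
oneTo-+ a zero    = trans (cong oneTo (ℕP.+-identityʳ a)) (sym (LP.++-identityʳ (oneTo a)))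
oneTo-+ a (suc b) = begin
  oneTo (a + suc b)                                    ≡⟨ cong oneTo (ℕP.+-suc a b) ⟩
  oneTo (a + b) ++ [ suc (a + b) ]                     ≡⟨ cong (_++ [ suc (a + b) ]) (oneTo-+ a b) ⟩
  (oneTo a ++ map (a +_) (oneTo b)) ++ [ suc (a + b) ] ≡⟨ LP.++-assoc (oneTo a) _ _ ⟩
  oneTo a ++ (map (a +_) (oneTo b) ++ [ suc (a + b) ]) ≡⟨ cong (λ z → oneTo a ++ (map (a +_) (oneTo b) ++ [ z ])) (ℕP.+-suc a b) ⟨
  oneTo a ++ (map (a +_) (oneTo b) ++ [ a + suc b ])   ≡⟨ cong (oneTo a ++_) (LP.map-++ (a +_) (oneTo b) [ suc b ]) ⟨
  oneTo a ++ map (a +_) (oneTo (suc b))                ∎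
  where open ≡-Reasoning

count : {P : Pred ℕ 0ℓ} → Decidable P → List ℕ → ℕ
count P? xs = length (filter P? xs)

module _ {P : Pred ℕ 0ℓ} (P? : Decidable P) where

  count-++ : ∀ xs ys → count P? (xs ++ ys) ≡ count P? xs + count P? ys
  count-++ xs ys = trans (cong length (LP.filter-++ P? xs ys)) (LP.length-++ (filter P? xs))

  count-map : ∀ f xs → count P? (map f xs) ≡ count (P? ∘ f) xs
  count-map f []       = refl
  count-map f (x ∷ xs) with P? (f x)
  ... | yes _ = cong suc (count-map f xs)
  ... | no  _ = count-map f xs

  count-[x]-accept : ∀ {x} → P x → count P? [ x ] ≡ 1
  count-[x]-accept {x} px with P? x
  ... | yes _ = refl
  ... | no ¬p = ⊥-elim (¬p px)

  count-[x]-reject : ∀ {x} → ¬ P x → count P? [ x ] ≡ 0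
  count-[x]-reject {x} ¬px with P? x
  ... | yes p = ⊥-elim (¬px p)
  ... | no  _ = refl

  count-none : ∀ n → (∀ j → 1 ≤ j → j ≤ n → ¬ P j) → count P? (oneTo n) ≡ 0
  count-none zero    h = refl
  count-none (suc n) h = trans (count-++ (oneTo n) [ suc n ])
    (cong₂ _+_ (count-none n λ j 1≤j j≤n → h j 1≤j (ℕP.m≤n⇒m≤1+n j≤n))
               (count-[x]-reject (h (suc n) (s≤s z≤n) ℕP.≤-refl)))

  module _ {Q : Pred ℕ 0ℓ} (Q? : Decidable Q) where

    count-cong : (∀ {x} → P x → Q x) → (∀ {x} → Q x → P x) → ∀ xs → count P? xs ≡ count Q? xs
    count-cong p⇒q q⇒p []       = refl
    count-cong p⇒q q⇒p (x ∷ xs) with P? x | Q? x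
    ... | yes _  | yes _  = cong suc (count-cong p⇒q q⇒p xs)
    ... | yes px | no ¬qx = ⊥-elim (¬qx (p⇒q px))
    ... | no ¬px | yes qx = ⊥-elim (¬px (q⇒p qx))
    ... | no _   | no _   = count-cong p⇒q q⇒p xs

    count-filter : ∀ xs → count P? (filter Q? xs) ≡ count (λ x → P? x ×-dec Q? x) xs
    count-filter []       = refl
    count-filter (x ∷ xs) with Q? x
    ... | yes _ with P? x
    ...   | yes _ = cong suc (count-filter xs)
    ...   | no _  = count-filter xs
    count-filter (x ∷ xs) | no _ with P? x
    ...   | yes _ = count-filter xs
    ...   | no _  = count-filter xs

    count-split : ∀ xs → count P? xs ≡ count (λ x → P? x ×-dec Q? x) xs + count (λ x → P? x ×-dec ¬? (Q? x)) xs
    count-split []       = refl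
    count-split (x ∷ xs) with P? x
    ... | no _ = count-split xs
    ... | yes _ with Q? x
    ...   | yes _ = cong suc (count-split xs)
    ...   | no _  = trans (cong suc (count-split xs)) (sym (ℕP.+-suc _ _))

count-≟ : ∀ c n → 1 ≤ c → c ≤ n → count (λ d → d ℕ.≟ c) (oneTo n) ≡ 1
count-≟ (suc c) zero (s≤s _) ()
count-≟ c (suc n) 1≤c c≤1+n with ℕP.m≤n⇒m<n∨m≡n c≤1+n
... | inj₁ (s≤s c≤n) = trans (count-++ (λ d → d ℕ.≟ c) (oneTo n) [ suc n ])
  (cong₂ _+_ (count-≟ c n 1≤c c≤n) (count-[x]-reject (λ d → d ℕ.≟ c) λ e → ℕP.<⇒≢ (s≤s c≤n) (sym e)))
... | inj₂ refl = trans (count-++ (λ d → d ℕ.≟ c) (oneTo n) [ suc n ])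
  (cong₂ _+_ (count-none (λ d → d ℕ.≟ c) n λ j _ j≤n e → ℕP.<⇒≢ (s≤s j≤n) e) (count-[x]-accept (λ d → d ℕ.≟ c) refl))

-- Only multiples of e can satisfy R, so [1‥e(d+1)] adds exactly one candidate to [1‥ed].
count-multiples : ∀ e d {R : Pred ℕ 0ℓ} (R? : Decidable R) → 1 ≤ e → (∀ {k} → R k → e ∣ k) →
                  count R? (oneTo (e * d)) ≡ count (R? ∘ (e *_)) (oneTo d)
count-multiples e zero R? 1≤e only = cong (count R? ∘ oneTo) (ℕP.*-zeroʳ e)
count-multiples e@(suc e′) (suc d) R? 1≤e only = begin
  count R? (oneTo (e * suc d))                                  ≡⟨ cong (count R? ∘ oneTo) e*[1+d] ⟩
  count R? (oneTo (e * d + e))                                  ≡⟨ cong (count R?) (oneTo-+ (e * d) e) ⟩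
  count R? (oneTo (e * d) ++ map (e * d +_) (oneTo e))          ≡⟨ count-++ R? (oneTo (e * d)) _ ⟩
  count R? (oneTo (e * d)) + count R? (map (e * d +_) (oneTo e))
    ≡⟨ cong₂ _+_ (count-multiples e d R? 1≤e only) (trans (count-map R? (e * d +_) (oneTo e)) lastBlock) ⟩
  count (R? ∘ (e *_)) (oneTo d) + count (R? ∘ (e *_)) [ suc d ] ≡⟨ count-++ (R? ∘ (e *_)) (oneTo d) [ suc d ] ⟨
  count (R? ∘ (e *_)) (oneTo (suc d))                           ∎
  where
  open ≡-Reasoning
  e*[1+d] : e * suc d ≡ e * d + e
  e*[1+d] = trans (ℕP.*-suc e d) (ℕP.+-comm e (e * d))
  lastBlock : count (R? ∘ (e * d +_)) (oneTo e) ≡ count (R? ∘ (e *_)) [ suc d ]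
  lastBlock = begin
    count (R? ∘ (e * d +_)) (oneTo e′ ++ [ e ])
      ≡⟨ count-++ (R? ∘ (e * d +_)) (oneTo e′) [ e ] ⟩
    count (R? ∘ (e * d +_)) (oneTo e′) + count (R? ∘ (e * d +_)) [ e ]
      ≡⟨ cong₂ _+_ none (trans (sym (count-map R? (e * d +_) [ e ])) (trans (cong (λ z → count R? [ z ]) (sym e*[1+d]))
                                                                        (count-map R? (e *_) [ suc d ]))) ⟩
    count (R? ∘ (e *_)) [ suc d ]
      ∎
    where
    none : count (R? ∘ (e * d +_)) (oneTo e′) ≡ 0
    none = count-none (R? ∘ (e * d +_)) e′ λ j 1≤j j≤e′ r →
      ℕP.<⇒≱ (s≤s j≤e′) (∣⇒≤ {{ℕ.>-nonZero 1≤j}} (∣m+n∣m⇒∣n (only r) (m∣m*n d)))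

coprime? : ∀ m → Decidable (λ k → gcd k m ≡ 1)
coprime? m k = gcd k m ℕ.≟ 1

totient≡count : ∀ m → totient m ≡ count (coprime? m) (oneTo m)
totient≡count m = cong (count (coprime? m)) (map-suc-upTo m)

gcd≡1-transfer : ∀ {a m b n} → (∀ {d} → d ∣ a → d ∣ m → d ∣ b × d ∣ n) → gcd b n ≡ 1 → gcd a m ≡ 1
gcd≡1-transfer {a} {m} {b} {n} common e =
  coprime⇒gcd≡1 {a} {m} λ (da , dm) → gcd≡1⇒coprime {b} {n} e (common da dm)

count-coprime-periodic : ∀ a m → count (coprime? m) (oneTo (a * m)) ≡ a * totient m
count-coprime-periodic zero    m = refl
count-coprime-periodic (suc a) m = begin
  count (coprime? m) (oneTo (m + a * m))                     ≡⟨ cong (count (coprime? m)) (oneTo-+ m (a * m)) ⟩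
  count (coprime? m) (oneTo m ++ map (m +_) (oneTo (a * m))) ≡⟨ count-++ (coprime? m) (oneTo m) _ ⟩
  count (coprime? m) (oneTo m) + count (coprime? m) (map (m +_) (oneTo (a * m)))
    ≡⟨ cong₂ _+_ (sym (totient≡count m)) (trans (count-map (coprime? m) (m +_) (oneTo (a * m))) shifted) ⟩
  totient m + a * totient m                                  ∎
  where
  open ≡-Reasoning
  shifted : count (coprime? m ∘ (m +_)) (oneTo (a * m)) ≡ a * totient m
  shifted = trans (count-cong (coprime? m ∘ (m +_)) (coprime? m)
                     (λ {x} → gcd≡1-transfer {x} {m} {m + x} λ dj dm → ∣m∣n⇒∣m+n dm dj , dm)
                     (λ {x} → gcd≡1-transfer {m + x} {m} {x} λ dmj dm → ∣m+n∣m⇒∣n dmj dm , dm) (oneTo (a * m)))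
                  (count-coprime-periodic a m)

module _ {p : ℕ} (p-prime : Prime p) where
  private
    p≢1 : p ≢ 1
    p≢1 = ℕ.nonTrivial⇒≢1 {{prime⇒nonTrivial p-prime}}

    coprime-prime : ∀ {d} → ¬ p ∣ d → Coprime d p
    coprime-prime p∤d (c∣d , c∣p) with prime⇒irreducible p-prime c∣p
    ... | inj₁ c≡1 = c≡1
    ... | inj₂ refl = ⊥-elim (p∤d c∣d)

  gcd[k,m*p]≡1⇒ : ∀ k m → gcd k (m * p) ≡ 1 → gcd k m ≡ 1 × ¬ p ∣ k
  gcd[k,m*p]≡1⇒ k m e =
    gcd≡1-transfer {k} {m} {k} {m * p} (λ dk dm → dk , ∣m⇒∣m*n p dm) e ,
    λ p∣k → p≢1 (gcd≡1⇒coprime {k} {m * p} e (p∣k , n∣m*n m))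

  gcd[k,m*p]≡1⇐ : ∀ k m → gcd k m ≡ 1 → ¬ p ∣ k → gcd k (m * p) ≡ 1
  gcd[k,m*p]≡1⇐ k m e p∤k = coprime⇒gcd≡1 {k} {m * p} λ {d} (d∣k , d∣mp) →
    gcd≡1⇒coprime {k} {m} e (d∣k , coprime-divisor {d} {p} {m} (coprime-prime λ p∣d → p∤k (∣-trans p∣d d∣k))
                                                                (subst (d ∣_) (ℕP.*-comm m p) d∣mp))

  gcd[p*j,m]≡1⇒ : ∀ j m → gcd (p * j) m ≡ 1 → gcd j m ≡ 1
  gcd[p*j,m]≡1⇒ j m = gcd≡1-transfer {j} {m} {p * j} {m} λ dj dm → ∣-trans dj (n∣m*n p) , dm

  gcd[p*j,m]≡1⇐ : ∀ j m → ¬ p ∣ m → gcd j m ≡ 1 → gcd (p * j) m ≡ 1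
  gcd[p*j,m]≡1⇐ j m p∤m e = coprime⇒gcd≡1 {p * j} {m} λ {d} (d∣pj , d∣m) →
    gcd≡1⇒coprime {j} {m} e (coprime-divisor {d} {p} {j} (coprime-prime λ p∣d → p∤m (∣-trans p∣d d∣m)) d∣pj , d∣m)

  totient-*-prime : ∀ m → ¬ p ∣ m → totient (m * p) + totient m ≡ p * totient m
  totient-*-prime m p∤m = sym (begin
    p * totient m                            ≡⟨ count-coprime-periodic p m ⟨
    count (coprime? m) range                 ≡⟨ count-split (coprime? m) (p ∣?_) range ⟩
    count withP range + count withoutP range ≡⟨ ℕP.+-comm (count withP range) _ ⟩
    count withoutP range + count withP range ≡⟨ cong₂ _+_ notMultiples multiples ⟩
    totient (m * p) + totient m              ∎)
    where
    open ≡-Reasoning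
    range = oneTo (p * m)
    withP = λ k → coprime? m k ×-dec (p ∣? k)
    withoutP = λ k → coprime? m k ×-dec ¬? (p ∣? k)
    notMultiples : count withoutP range ≡ totient (m * p)
    notMultiples = begin
      count withoutP range
        ≡⟨ count-cong withoutP (coprime? (m * p)) (λ {k} (e , p∤k) → gcd[k,m*p]≡1⇐ k m e p∤k) (λ {k} → gcd[k,m*p]≡1⇒ k m) range ⟩
      count (coprime? (m * p)) range           ≡⟨ cong (count (coprime? (m * p)) ∘ oneTo) (ℕP.*-comm p m) ⟩
      count (coprime? (m * p)) (oneTo (m * p)) ≡⟨ totient≡count (m * p) ⟨
      totient (m * p)                          ∎
    multiples : count withP range ≡ totient m
    multiples = begin
      count withP range
        ≡⟨ count-multiples p m withP (ℕP.<⇒≤ (ℕ.nonTrivial⇒n>1 p {{prime⇒nonTrivial p-prime}})) proj₂ ⟩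
      count (withP ∘ (p *_)) (oneTo m)
        ≡⟨ count-cong (withP ∘ (p *_)) (coprime? m) (λ {j} (e , _) → gcd[p*j,m]≡1⇒ j m e)
                                                    (λ {j} e → gcd[p*j,m]≡1⇐ j m p∤m e , m∣m*n j) (oneTo m) ⟩
      count (coprime? m) (oneTo m) ≡⟨ totient≡count m ⟨
      totient m                    ∎

totient-positive : ∀ m → 1 ≤ m → 1 ≤ totient m
totient-positive (suc m) _ = subst (1 ≤_) (sym (totient≡count (suc m))) (begin
  1                                                                                ≡⟨ count-[x]-accept (coprime? (suc m)) {1} (gcd-zeroˡ (suc m)) ⟨
  count (coprime? (suc m)) [ 1 ]                                                   ≤⟨ ℕP.m≤m+n _ _ ⟩
  count (coprime? (suc m)) [ 1 ] + count (coprime? (suc m)) (map (1 +_) (oneTo m)) ≡⟨ count-++ (coprime? (suc m)) [ 1 ] _ ⟨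
  count (coprime? (suc m)) ([ 1 ] ++ map (1 +_) (oneTo m))                         ≡⟨ cong (count (coprime? (suc m))) (oneTo-+ 1 m) ⟨
  count (coprime? (suc m)) (oneTo (suc m))                                         ∎)
  where open ℕP.≤-Reasoning

cofactor? : ∀ n d → Decidable (λ k → gcd k n * d ≡ n)
cofactor? n d k = gcd k n * d ℕ.≟ n

-- k ∈ [1‥ed] has gcd(k, ed) = e exactly when k = ej with j ∈ [1‥d] coprime to d.
totient≡count-cofactor : ∀ e d → 1 ≤ e → 1 ≤ d → totient d ≡ count (cofactor? (e * d) d) (oneTo (e * d))
totient≡count-cofactor e d@(suc _) 1≤e _ = sym (begin
  count (cofactor? (e * d) d) (oneTo (e * d)) ≡⟨ count-multiples e d (cofactor? (e * d) d) 1≤e e∣k ⟩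
  count (cofactor? (e * d) d ∘ (e *_)) (oneTo d)
    ≡⟨ count-cong _ (coprime? d) (λ {j} → cofactor⇒ j) (λ {j} → cofactor⇐ j) (oneTo d) ⟩
  count (coprime? d) (oneTo d)                ≡⟨ totient≡count d ⟨
  totient d                                   ∎)
  where
  open ≡-Reasoning
  e∣k : ∀ {k} → gcd k (e * d) * d ≡ e * d → e ∣ k
  e∣k {k} eq = subst (_∣ k) (ℕP.*-cancelʳ-≡ (gcd k (e * d)) e d eq) (gcd[m,n]∣m k (e * d))
  gcd[ej,ed] : ∀ j → gcd (e * j) (e * d) ≡ e * gcd j d
  gcd[ej,ed] j = sym (c*gcd[m,n]≡gcd[cm,cn] e j d)
  cofactor⇒ : ∀ j → gcd (e * j) (e * d) * d ≡ e * d → gcd j d ≡ 1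
  cofactor⇒ j eq = ℕP.*-cancelˡ-≡ (gcd j d) 1 e {{ℕ.>-nonZero 1≤e}}
    (trans (ℕP.*-cancelʳ-≡ (e * gcd j d) e d (trans (cong (_* d) (sym (gcd[ej,ed] j))) eq)) (sym (ℕP.*-identityʳ e)))
  cofactor⇐ : ∀ j → gcd j d ≡ 1 → gcd (e * j) (e * d) * d ≡ e * d
  cofactor⇐ j eq = cong (_* d) (trans (gcd[ej,ed] j) (trans (cong (e *_) eq) (ℕP.*-identityʳ e)))

-- Counting the pairs (d, x) with R d x in two ways, when each x has exactly one d.
sum-count-partition : ∀ {R : ℕ → ℕ → Set} (R? : ∀ d x → Dec (R d x)) ds xs →
                      (∀ x → count (λ d → R? d x) ds ≡ 1) → sum (map (λ d → count (R? d) xs) ds) ≡ length xs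
sum-count-partition R? ds []       unique = sum-zeros ds
  where
  sum-zeros : ∀ ds → sum (map (λ d → count (R? d) []) ds) ≡ 0
  sum-zeros []       = refl
  sum-zeros (_ ∷ ds) = sum-zeros ds
sum-count-partition R? ds (x ∷ xs) unique = begin
  sum (map (λ d → count (R? d) ([ x ] ++ xs)) ds)           ≡⟨ cong sum (LP.map-cong (λ d → count-++ (R? d) [ x ] xs) ds) ⟩
  sum (map (λ d → count (R? d) [ x ] + count (R? d) xs) ds) ≡⟨ sum-map-+ (λ d → count (R? d) [ x ]) (λ d → count (R? d) xs) ds ⟩
  sum (map (λ d → count (R? d) [ x ]) ds) + sum (map (λ d → count (R? d) xs) ds)
    ≡⟨ cong₂ _+_ (trans (sum-singleton ds) (unique x)) (sum-count-partition R? ds xs unique) ⟩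
  suc (length xs)                                           ∎
  where
  open ≡-Reasoning
  sum-singleton : ∀ ds → sum (map (λ d → count (R? d) [ x ]) ds) ≡ count (λ d → R? d x) ds
  sum-singleton []       = refl
  sum-singleton (d ∷ ds) with R? d x
  ... | yes _ = cong suc (sum-singleton ds)
  ... | no _  = sum-singleton ds
  sum-map-+ : ∀ (f g : ℕ → ℕ) ds → sum (map (λ d → f d + g d) ds) ≡ sum (map f ds) + sum (map g ds)
  sum-map-+ f g []       = refl
  sum-map-+ f g (d ∷ ds) = trans (cong (f d + g d +_) (sum-map-+ f g ds))
    (CommSemigroupProperties.interchange ℕP.+-commutativeSemigroup (f d) (g d) _ _)

sum-map-filter-cong : ∀ {P : Pred ℕ 0ℓ} (P? : Decidable P) {f h : ℕ → ℕ} → (∀ {d} → P d → f d ≡ h d) →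
                      ∀ xs → sum (map f (filter P? xs)) ≡ sum (map h (filter P? xs))
sum-map-filter-cong P? f≡h []       = refl
sum-map-filter-cong P? f≡h (x ∷ xs) with P? x
... | yes px = cong₂ _+_ (f≡h px) (sum-map-filter-cong P? f≡h xs)
... | no _   = sum-map-filter-cong P? f≡h xs

-- The only such d is n / gcd(x, n).
count-cofactor-divisors : ∀ n → 1 ≤ n → ∀ x → count (λ d → cofactor? n d x) (filter (_∣? n) (oneTo n)) ≡ 1
count-cofactor-divisors n@(suc _) _ x with gcd[m,n]∣n x n
... | divides c eq = begin
  count (λ d → cofactor? n d x) (filter (_∣? n) (oneTo n)) ≡⟨ count-filter (λ d → cofactor? n d x) (_∣? n) (oneTo n) ⟩
  count (λ d → cofactor? n d x ×-dec (d ∣? n)) (oneTo n)   ≡⟨ count-cong _ (λ d → d ℕ.≟ c) is-c is-cofactor (oneTo n) ⟩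
  count (λ d → d ℕ.≟ c) (oneTo n)                          ≡⟨ count-≟ c n 1≤c c≤n ⟩
  1                                                        ∎
  where
  open ≡-Reasoning
  instance
    g≢0 : NonZero (gcd x n)
    g≢0 = ℕ.≢-nonZero (gcd[m,n]≢0 x n (inj₂ λ ()))
  is-c : ∀ {d} → (gcd x n * d ≡ n) × d ∣ n → d ≡ c
  is-c {d} (g*d≡n , _) = ℕP.*-cancelʳ-≡ d c (gcd x n) (trans (ℕP.*-comm d (gcd x n)) (trans g*d≡n eq))
  is-cofactor : ∀ {d} → d ≡ c → (gcd x n * d ≡ n) × d ∣ n
  is-cofactor refl = trans (ℕP.*-comm (gcd x n) c) (sym eq) , divides (gcd x n) (trans eq (ℕP.*-comm c (gcd x n)))
  1≤c : 1 ≤ c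
  1≤c = ℕP.n≢0⇒n>0 λ { refl → ℕP.0≢1+n (sym eq) }
  c≤n : c ≤ n
  c≤n = ∣⇒≤ (divides (gcd x n) (trans eq (ℕP.*-comm c (gcd x n))))

sum-totient-divisors : ∀ n → 1 ≤ n → sum (map totient (filter (_∣? n) (oneTo n))) ≡ n
sum-totient-divisors n@(suc _) _ = begin
  sum (map totient divisors) ≡⟨ sum-map-filter-cong (_∣? n) totient≡ (oneTo n) ⟩
  sum (map (λ d → count (cofactor? n d) (oneTo n)) divisors)
    ≡⟨ sum-count-partition (cofactor? n) divisors (oneTo n) (count-cofactor-divisors n (s≤s z≤n)) ⟩
  length (oneTo n)           ≡⟨ length-oneTo n ⟩
  n                          ∎
  where
  open ≡-Reasoning
  divisors = filter (_∣? n) (oneTo n)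
  totient≡ : ∀ {d} → d ∣ n → totient d ≡ count (cofactor? n d) (oneTo n)
  totient≡ {d} (divides e n≡e*d) = subst (λ n → totient d ≡ count (cofactor? n d) (oneTo n)) (sym n≡e*d)
    (totient≡count-cofactor e d (ℕ.>-nonZero⁻¹ e {{ℕP.m*n≢0⇒m≢0 e}}) (ℕ.>-nonZero⁻¹ d {{ℕP.m*n≢0⇒n≢0 e}}))
    where
    instance
      e*d≢0 : NonZero (e * d)
      e*d≢0 = subst NonZero n≡e*d _

-- Divisibility and coprimality in ℤ[x]

∣ₚ-refl : ∀ a → a ∣ₚ a
∣ₚ-refl a = 1ₚ , *ₚ-identityˡ a

∣ₚ-trans : ∀ {a b c} → a ∣ₚ b → b ∣ₚ c → a ∣ₚ c
∣ₚ-trans {a} (q , e) (q′ , e′) = q′ *ₚ q , ≈-trans (*ₚ-assoc q′ q a) (≈-trans (*ₚ-cong (≈-refl {q′}) e) e′)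

∣ₚ-respʳ-≈ : ∀ {a b c} → b ≈ c → a ∣ₚ b → a ∣ₚ c
∣ₚ-respʳ-≈ e (q , e′) = q , ≈-trans e′ e

∣ₚ-respˡ-≈ : ∀ {a b c} → a ≈ b → a ∣ₚ c → b ∣ₚ c
∣ₚ-respˡ-≈ {a} {b} e (q , e′) = q , ≈-trans (*ₚ-cong (≈-refl {q}) (≈-sym e)) e′

∣ₚ-*ʳ : ∀ a b → a ∣ₚ a *ₚ b
∣ₚ-*ʳ a b = b , *ₚ-comm b a

*ₚ-∣ₚ-*ₚ : ∀ {a b c d} → a ∣ₚ b → c ∣ₚ d → a *ₚ c ∣ₚ b *ₚ d
*ₚ-∣ₚ-*ₚ {a} {b} {c} {d} (q , e) (q′ , e′) =
  q *ₚ q′ , ≈-trans (solve 4 (λ q q′ a c → ((q ⊗ q′) ⊗ (a ⊗ c)) ⊜ ((q ⊗ a) ⊗ (q′ ⊗ c))) ≈-refl q q′ a c) (*ₚ-cong e e′)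

-- ℤ[x] is not a principal ideal domain, so coprimality is witnessed by a Bézout identity up to a nonzero constant.
Coprimeₚ : Poly → Poly → Set
Coprimeₚ a b = Σ ℤ λ c → (c ≢ 0ℤ) × Σ Poly λ u → Σ Poly λ v → u *ₚ a +ₚ v *ₚ b ≈ const c

Coprimeₚ-sym : ∀ {a b} → Coprimeₚ a b → Coprimeₚ b a
Coprimeₚ-sym {a} {b} (c , c≢0 , u , v , e) = c , c≢0 , v , u , ≈-trans (+ₚ-comm (v *ₚ b) (u *ₚ a)) e

Coprimeₚ-1ₚ : ∀ a → Coprimeₚ a 1ₚ
Coprimeₚ-1ₚ a = 1ℤ , (λ ()) , [] , 1ₚ , mk≈ λ { zero → refl ; (suc k) → refl }

Coprimeₚ-*ₚ : ∀ {a b c} → Coprimeₚ a b → Coprimeₚ a c → Coprimeₚ a (b *ₚ c)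
Coprimeₚ-*ₚ {a} {b} {c} (k , k≢0 , u , v , e) (k′ , k′≢0 , u′ , v′ , e′) =
  k ℤ.* k′ , k*k′≢0 , u *ₚ u′ *ₚ a +ₚ u *ₚ v′ *ₚ c +ₚ v *ₚ b *ₚ u′ , v *ₚ v′ , (begin
    (u *ₚ u′ *ₚ a +ₚ u *ₚ v′ *ₚ c +ₚ v *ₚ b *ₚ u′) *ₚ a +ₚ v *ₚ v′ *ₚ (b *ₚ c)
      ≈⟨ solve 7 (λ u u′ v v′ a b c → ((((u ⊗ u′) ⊗ a) ⊕ ((u ⊗ v′) ⊗ c) ⊕ ((v ⊗ b) ⊗ u′)) ⊗ a) ⊕ ((v ⊗ v′) ⊗ (b ⊗ c))
                 ⊜ (((u ⊗ a) ⊕ (v ⊗ b)) ⊗ ((u′ ⊗ a) ⊕ (v′ ⊗ c)))) ≈-refl u u′ v v′ a b c ⟩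
    (u *ₚ a +ₚ v *ₚ b) *ₚ (u′ *ₚ a +ₚ v′ *ₚ c) ≈⟨ *ₚ-cong e e′ ⟩
    const k *ₚ const k′                        ≈⟨ mk≈ (λ j → trans (coeff-const-*ₚ k (const k′) j) (sym (const-* j))) ⟩
    const (k ℤ.* k′)                           ∎)
  where
  open SetoidReasoning ≈-setoid
  k*k′≢0 : k ℤ.* k′ ≢ 0ℤ
  k*k′≢0 e with ℤP.i*j≡0⇒i≡0∨j≡0 k e
  ... | inj₁ k≡0  = k≢0 k≡0
  ... | inj₂ k′≡0 = k′≢0 k′≡0
  const-* : ∀ j → coeff (const (k ℤ.* k′)) j ≡ k ℤ.* coeff (const k′) j
  const-* zero    = refl
  const-* (suc j) = sym (ℤP.*-zeroʳ k)

Coprimeₚ-∣ₚ : ∀ {a b c} → Coprimeₚ a b → c ∣ₚ b → Coprimeₚ a c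
Coprimeₚ-∣ₚ {a} {b} {c} (k , k≢0 , u , v , e) (q , q*c≈b) =
  k , k≢0 , u , v *ₚ q , ≈-trans (+ₚ-cong (≈-refl {u *ₚ a}) (≈-trans (*ₚ-assoc v q c) (*ₚ-cong (≈-refl {v}) q*c≈b))) e

Coprimeₚ-respʳ-≈ : ∀ {a b c} → b ≈ c → Coprimeₚ a b → Coprimeₚ a c
Coprimeₚ-respʳ-≈ {a} {b} {c} b≈c cop = Coprimeₚ-∣ₚ cop (1ₚ , ≈-trans (*ₚ-identityˡ c) (≈-sym b≈c))

Coprimeₚ-via-cofactor : ∀ {a r x y z k} → k ≢ 0ℤ → a *ₚ r *ₚ x ≈ y →
                        (Σ Poly λ w → a *ₚ r ≈ const k +ₚ w *ₚ x) →
                        (Σ Poly λ u → Σ Poly λ v → u *ₚ y +ₚ v *ₚ z ≈ x) → Coprimeₚ a z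
Coprimeₚ-via-cofactor {a} {r} {x} {y} {z} {k} k≢0 ar*x≈y (w , ar≈k+wx) (u , v , uy+vz≈x) =
  k , k≢0 , r -ₚ w *ₚ u *ₚ r *ₚ x , negₚ (w *ₚ v) , (begin
    (r -ₚ w *ₚ u *ₚ r *ₚ x) *ₚ a +ₚ negₚ (w *ₚ v) *ₚ z
      ≈⟨ solve 7 (λ a r w u v x z → (((r ⊕ (⊝ (((w ⊗ u) ⊗ r) ⊗ x))) ⊗ a) ⊕ ((⊝ (w ⊗ v)) ⊗ z))
                   ⊜ ((a ⊗ r) ⊕ (⊝ (w ⊗ ((u ⊗ ((a ⊗ r) ⊗ x)) ⊕ (v ⊗ z)))))) ≈-refl a r w u v x z ⟩
    a *ₚ r -ₚ w *ₚ (u *ₚ (a *ₚ r *ₚ x) +ₚ v *ₚ z)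
      ≈⟨ +ₚ-cong (≈-refl {a *ₚ r})
                 (negₚ-cong (*ₚ-cong (≈-refl {w}) (≈-trans (+ₚ-cong (*ₚ-cong (≈-refl {u}) ar*x≈y) ≈-refl) uy+vz≈x))) ⟩
    a *ₚ r -ₚ w *ₚ x
      ≈⟨ +ₚ-cong ar≈k+wx ≈-refl ⟩
    const k +ₚ w *ₚ x -ₚ w *ₚ x
      ≈⟨ solve 2 (λ c b → ((c ⊕ b) ⊕ (⊝ b)) ⊜ c) ≈-refl (const k) (w *ₚ x) ⟩
    const k ∎)
  where open SetoidReasoning ≈-setoid

*ₚ-∣ₚ-coprime : ∀ {D a b c} → Monic D (a *ₚ b) → a ∣ₚ c → b ∣ₚ c → Coprimeₚ a b → a *ₚ b ∣ₚ c
*ₚ-∣ₚ-coprime {D} {a} {b} {c} mab (α , α*a≈c) (β , β*b≈c) (k , k≢0 , u , v , e) =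
  ∣ₚ-cancel-const mab k≢0 c (u *ₚ β +ₚ v *ₚ α , (begin
    (u *ₚ β +ₚ v *ₚ α) *ₚ (a *ₚ b)
      ≈⟨ solve 6 (λ u β v α a b → (((u ⊗ β) ⊕ (v ⊗ α)) ⊗ (a ⊗ b)) ⊜ (((u ⊗ a) ⊗ (β ⊗ b)) ⊕ ((v ⊗ b) ⊗ (α ⊗ a)))) ≈-refl u β v α a b ⟩
    (u *ₚ a) *ₚ (β *ₚ b) +ₚ (v *ₚ b) *ₚ (α *ₚ a)
      ≈⟨ +ₚ-cong (*ₚ-cong (≈-refl {u *ₚ a}) β*b≈c) (*ₚ-cong (≈-refl {v *ₚ b}) α*a≈c) ⟩
    (u *ₚ a) *ₚ c +ₚ (v *ₚ b) *ₚ c ≈⟨ *ₚ-distribʳ c (u *ₚ a) (v *ₚ b) ⟨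
    (u *ₚ a +ₚ v *ₚ b) *ₚ c        ≈⟨ *ₚ-cong e (≈-refl {c}) ⟩
    const k *ₚ c                   ∎))
  where open SetoidReasoning ≈-setoid

coprime-∣ₚ-*ₚ⇒∣ₚ : ∀ {D a b c} → Monic D a → a ∣ₚ b *ₚ c → Coprimeₚ a c → a ∣ₚ b
coprime-∣ₚ-*ₚ⇒∣ₚ {D} {a} {b} {c} ma (β , β*a≈bc) (k , k≢0 , u , v , e) =
  ∣ₚ-cancel-const ma k≢0 b (u *ₚ b +ₚ v *ₚ β , (begin
    (u *ₚ b +ₚ v *ₚ β) *ₚ a
      ≈⟨ solve 5 (λ u b v β a → (((u ⊗ b) ⊕ (v ⊗ β)) ⊗ a) ⊜ (((u ⊗ a) ⊗ b) ⊕ (v ⊗ (β ⊗ a)))) ≈-refl u b v β a ⟩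
    (u *ₚ a) *ₚ b +ₚ v *ₚ (β *ₚ a) ≈⟨ +ₚ-cong (≈-refl {(u *ₚ a) *ₚ b}) (*ₚ-cong (≈-refl {v}) β*a≈bc) ⟩
    (u *ₚ a) *ₚ b +ₚ v *ₚ (b *ₚ c)
      ≈⟨ solve 5 (λ u a b v c → (((u ⊗ a) ⊗ b) ⊕ (v ⊗ (b ⊗ c))) ⊜ (((u ⊗ a) ⊕ (v ⊗ c)) ⊗ b)) ≈-refl u a b v c ⟩
    (u *ₚ a +ₚ v *ₚ c) *ₚ b        ≈⟨ *ₚ-cong e (≈-refl {b}) ⟩
    const k *ₚ b                   ∎))
  where open SetoidReasoning ≈-setoid

prodP-++ : ∀ ps qs → prodP (ps ++ qs) ≈ prodP ps *ₚ prodP qs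
prodP-++ []       qs = ≈-sym (*ₚ-identityˡ _)
prodP-++ (p ∷ ps) qs = ≈-trans (*ₚ-cong (≈-refl {p}) (prodP-++ ps qs)) (≈-sym (*ₚ-assoc p (prodP ps) (prodP qs)))

sdiv-unique : ∀ k r b t → coeff b 0 ℤ.* coeff b 0 ≡ 1ℤ → t *ₚ b ≈ r → DegBelow k t → sdiv k r b ≈ t
sdiv-unique zero    r b t b₀²≡1 e z = mk≈ λ j → sym (z j z≤n)
sdiv-unique (suc k) r b t b₀²≡1 e z =
  ≈-trans (∷-cong c≡t₀ (sdiv-unique k _ b (drop 1 t) b₀²≡1 tail*b≈ λ j le → trans (coeff-drop1 t j) (z (suc j) (s≤s le))))
          (head∷drop t)
  where
  t₀ = coeff t 0
  b₀ = coeff b 0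
  c = b₀ ℤ.* coeff r 0
  c≡t₀ : c ≡ t₀
  c≡t₀ = trans (cong (b₀ ℤ.*_) (trans (sym (at e 0)) (coeff-*ₚ t b 0)))
           (trans (rearrange b₀ t₀) (trans (cong (t₀ ℤ.*_) b₀²≡1) (ℤP.*-identityʳ t₀)))
    where
    rearrange : ∀ b t → b ℤ.* (t ℤ.* b) ≡ t ℤ.* (b ℤ.* b)
    rearrange = solve-∀
  head∷drop : ∀ t → coeff t 0 ∷ drop 1 t ≈ t
  head∷drop []      = mk≈ λ { zero → refl ; (suc k) → refl }
  head∷drop (a ∷ t) = ≈-refl
  tail*b≈ : drop 1 t *ₚ b ≈ drop 1 (r -ₚ scale c b)
  tail*b≈ = mk≈ λ j → sym (begin
    coeff (drop 1 (r -ₚ scale c b)) j ≡⟨ coeff-drop1 (r -ₚ scale c b) j ⟩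
    coeff (r -ₚ scale c b) (suc j)    ≡⟨ coeff--ₚ r (scale c b) (suc j) ⟩
    coeff r (suc j) ℤ.- coeff (scale c b) (suc j)
      ≡⟨ cong₂ ℤ._-_ (trans (sym (at e (suc j))) (coeff-*ₚ t b (suc j)))
                     (trans (coeff-scale c b (suc j)) (cong (ℤ._* coeff b (suc j)) c≡t₀)) ⟩
    t₀ ℤ.* coeff b (suc j) ℤ.+ conv (coeff t ∘ suc) (coeff b) j ℤ.- t₀ ℤ.* coeff b (suc j)
      ≡⟨ cancel (t₀ ℤ.* coeff b (suc j)) _ ⟩
    conv (coeff t ∘ suc) (coeff b) j    ≡⟨ conv-cong (λ i → sym (coeff-drop1 t i)) (λ _ → refl) j ⟩
    conv (coeff (drop 1 t)) (coeff b) j ≡⟨ coeff-*ₚ (drop 1 t) b j ⟨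
    coeff (drop 1 t *ₚ b) j             ∎)
    where
    open ≡-Reasoning
    cancel : ∀ a x → a ℤ.+ x ℤ.- a ≡ x
    cancel = solve-∀

-- The computed Φ n is the n-th cyclotomic polynomial

<⇒≤∸1 : ∀ {m n} → m < n → m ≤ n ∸ 1
<⇒≤∸1 (s≤s m≤n) = m≤n

∏Φ : List ℕ → Poly
∏Φ ds = prodP (map Φ ds)

divisorsUpTo : ℕ → ℕ → List ℕ
divisorsUpTo n k = filter (_∣? n) (oneTo k)

properProduct : ℕ → Poly
properProduct n = ∏Φ (divisorsUpTo n (n ∸ 1))

Φ-unfold : ∀ k → Φ (suc k) ≡ sdiv (suc (suc k)) (xⁿ-1 (suc k)) (properProduct (suc k))
Φ-unfold k = cong (sdiv (suc (suc k)) (xⁿ-1 (suc k)) ∘ prodP) (begin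
  map proj₂ (filter (λ e → proj₁ e ∣? suc k) (cycTable k))
    ≡⟨ cong (map proj₂ ∘ filter (λ e → proj₁ e ∣? suc k)) (table≡ k) ⟩
  map proj₂ (filter (λ e → proj₁ e ∣? suc k) (map (λ d → d , Φ d) (oneTo k)))
    ≡⟨ cong (map proj₂) (filter-map (λ e → proj₁ e ∣? suc k) (λ d → d , Φ d) (oneTo k)) ⟩
  map proj₂ (map (λ d → d , Φ d) (divisorsUpTo (suc k) k))
    ≡⟨ LP.map-∘ (divisorsUpTo (suc k) k) ⟨
  map Φ (divisorsUpTo (suc k) k)
    ∎)
  where
  open ≡-Reasoning
  table≡ : ∀ k → cycTable k ≡ map (λ d → d , Φ d) (oneTo k)
  table≡ zero    = refl
  table≡ (suc k) = trans (cong (_++ [ suc k , Φ (suc k) ]) (table≡ k)) (sym (LP.map-++ (λ d → d , Φ d) (oneTo k) [ suc k ]))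
  filter-map : ∀ {A B : Set} {P : Pred B 0ℓ} (P? : Decidable P) (f : A → B) xs →
               filter P? (map f xs) ≡ map f (filter (P? ∘ f) xs)
  filter-map P? f []       = refl
  filter-map P? f (x ∷ xs) with P? (f x)
  ... | yes _ = cong (f x ∷_) (filter-map P? f xs)
  ... | no _  = filter-map P? f xs

sum-totient-properDivisors : ∀ N → sum (map totient (divisorsUpTo (suc N) N)) + totient (suc N) ≡ suc N
sum-totient-properDivisors N = begin
  sum (map totient ds) + totient n               ≡⟨ cong (sum (map totient ds) +_) (ℕP.+-identityʳ (totient n)) ⟨
  sum (map totient ds) + sum (map totient [ n ]) ≡⟨ sum-++ (map totient ds) _ ⟨
  sum (map totient ds ++ map totient [ n ])      ≡⟨ cong sum (LP.map-++ totient ds [ n ]) ⟨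
  sum (map totient (ds ++ [ n ]))                ≡⟨ cong (sum ∘ map totient ∘ (ds ++_)) (LP.filter-accept (_∣? n) {n} {[]} ∣-refl) ⟨
  sum (map totient (ds ++ filter (_∣? n) [ n ])) ≡⟨ cong (sum ∘ map totient) (LP.filter-++ (_∣? n) (oneTo N) [ n ]) ⟨
  sum (map totient (divisorsUpTo n n))           ≡⟨ sum-totient-divisors n (s≤s z≤n) ⟩
  n                                              ∎
  where
  open ≡-Reasoning
  n = suc N
  ds = divisorsUpTo n N

record IsCyclotomic (d : ℕ) : Set where
  field
    monic         : Monic (totient d) (Φ d)
    factorisation : Φ d *ₚ properProduct d ≈ xⁿ-1 d
    unitConstant  : coeff (Φ d) 0 ℤ.* coeff (Φ d) 0 ≡ 1ℤ

  ∣xⁿ-1 : Φ d ∣ₚ xⁿ-1 d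
  ∣xⁿ-1 = properProduct d , ≈-trans (*ₚ-comm (properProduct d) (Φ d)) factorisation
open IsCyclotomic

CyclotomicUpTo : ℕ → Set
CyclotomicUpTo N = ∀ {d} → 1 ≤ d → d ≤ N → IsCyclotomic d

∏Φ-monic : ∀ ds → All IsCyclotomic ds →
           Monic (sum (map totient ds)) (∏Φ ds) × (coeff (∏Φ ds) 0 ℤ.* coeff (∏Φ ds) 0 ≡ 1ℤ)
∏Φ-monic []       []           = (refl , λ { (suc j) _ → refl }) , refl
∏Φ-monic (d ∷ ds) (cyc ∷ cycs) with ∏Φ-monic ds cycs
... | mds , uds = Monic-*ₚ {p = Φ d} {q = ∏Φ ds} (monic cyc) mds ,
  trans (cong (λ w → w ℤ.* w) (coeff-*ₚ (Φ d) (∏Φ ds) 0))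
        (trans (regroup (coeff (Φ d) 0) (coeff (∏Φ ds) 0)) (cong₂ ℤ._*_ (unitConstant cyc) uds))
  where
  regroup : ∀ a b → (a ℤ.* b) ℤ.* (a ℤ.* b) ≡ (a ℤ.* a) ℤ.* (b ℤ.* b)
  regroup = solve-∀

∏Φ-++ : ∀ ds es → ∏Φ (ds ++ es) ≈ ∏Φ ds *ₚ ∏Φ es
∏Φ-++ ds es = ≈-trans (≈-reflexive (cong prodP (LP.map-++ Φ ds es))) (prodP-++ (map Φ ds) (map Φ es))

∏Φ-filter-∣ₚ : ∀ {P Q : Pred ℕ 0ℓ} (P? : Decidable P) (Q? : Decidable Q) → (∀ {x} → P x → Q x) →
               ∀ xs → ∏Φ (filter P? xs) ∣ₚ ∏Φ (filter Q? xs)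
∏Φ-filter-∣ₚ P? Q? P⇒Q []       = ∣ₚ-refl 1ₚ
∏Φ-filter-∣ₚ P? Q? P⇒Q (x ∷ xs) with P? x | Q? x
... | yes _  | yes _  = *ₚ-∣ₚ-*ₚ (∣ₚ-refl (Φ x)) (∏Φ-filter-∣ₚ P? Q? P⇒Q xs)
... | yes px | no ¬qx = ⊥-elim (¬qx (P⇒Q px))
... | no _   | yes _  = ∣ₚ-trans (∏Φ-filter-∣ₚ P? Q? P⇒Q xs) (Φ x , ≈-refl)
... | no _   | no _   = ∏Φ-filter-∣ₚ P? Q? P⇒Q xs

∏Φ-divisorsUpTo-mono : ∀ n {k K} → k ≤ K → ∏Φ (divisorsUpTo n k) ∣ₚ ∏Φ (divisorsUpTo n K)
∏Φ-divisorsUpTo-mono n {k} {K} k≤K = ∣ₚ-respʳ-≈ (≈-sym (begin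
  ∏Φ (divisorsUpTo n K)
    ≈⟨ ≈-reflexive (cong (∏Φ ∘ filter (_∣? n)) (trans (cong oneTo (sym (ℕP.m+[n∸m]≡n k≤K))) (oneTo-+ k (K ∸ k)))) ⟩
  ∏Φ (filter (_∣? n) (oneTo k ++ rest))
    ≈⟨ ≈-reflexive (cong ∏Φ (LP.filter-++ (_∣? n) (oneTo k) rest)) ⟩
  ∏Φ (divisorsUpTo n k ++ filter (_∣? n) rest)
    ≈⟨ ∏Φ-++ (divisorsUpTo n k) _ ⟩
  ∏Φ (divisorsUpTo n k) *ₚ ∏Φ (filter (_∣? n) rest) ∎))
  (∣ₚ-*ʳ (∏Φ (divisorsUpTo n k)) _)
  where
  open SetoidReasoning ≈-setoid
  rest = map (k +_) (oneTo (K ∸ k))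

∏Φ-divisorsUpTo-suc : ∀ n k → ∏Φ (divisorsUpTo n (suc k)) ≈ ∏Φ (divisorsUpTo n k) *ₚ ∏Φ (filter (_∣? n) [ suc k ])
∏Φ-divisorsUpTo-suc n k =
  ≈-trans (≈-reflexive (cong ∏Φ (LP.filter-++ (_∣? n) (oneTo k) [ suc k ]))) (∏Φ-++ (divisorsUpTo n k) _)

∏Φ-[x]-accept : ∀ {n x} → x ∣ n → ∏Φ (filter (_∣? n) [ x ]) ≈ Φ x
∏Φ-[x]-accept {n} {x} x∣n rewrite LP.filter-accept (_∣? n) {x} {[]} x∣n = *ₚ-identityʳ (Φ x)

∏Φ-[x]-reject : ∀ {n x} → ¬ x ∣ n → ∏Φ (filter (_∣? n) [ x ]) ≈ 1ₚ
∏Φ-[x]-reject {n} {x} x∤n rewrite LP.filter-reject (_∣? n) {x} {[]} x∤n = ≈-refl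

divisorsUpTo-bounds : ∀ n k → All (λ d → 1 ≤ d × d ≤ k) (divisorsUpTo n k)
divisorsUpTo-bounds n k = AllP.filter⁺ (_∣? n) (bounds k)
  where
  bounds : ∀ k → All (λ d → 1 ≤ d × d ≤ k) (oneTo k)
  bounds zero    = []
  bounds (suc k) = AllP.++⁺ (All.map (λ (1≤d , d≤k) → 1≤d , ℕP.m≤n⇒m≤1+n d≤k) (bounds k)) ((s≤s z≤n , ℕP.≤-refl) ∷ [])

∏Φ-divisors≈xⁿ-1 : ∀ {d} → 1 ≤ d → IsCyclotomic d → ∏Φ (divisorsUpTo d d) ≈ xⁿ-1 d
∏Φ-divisors≈xⁿ-1 {suc d} _ cyc = begin
  ∏Φ (divisorsUpTo (suc d) (suc d))                          ≈⟨ ∏Φ-divisorsUpTo-suc (suc d) d ⟩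
  properProduct (suc d) *ₚ ∏Φ (filter (_∣? suc d) [ suc d ]) ≈⟨ *ₚ-cong (≈-refl {properProduct (suc d)}) (∏Φ-[x]-accept ∣-refl) ⟩
  properProduct (suc d) *ₚ Φ (suc d)                         ≈⟨ *ₚ-comm (properProduct (suc d)) (Φ (suc d)) ⟩
  Φ (suc d) *ₚ properProduct (suc d)                         ≈⟨ factorisation cyc ⟩
  xⁿ-1 (suc d)                                               ∎
  where open SetoidReasoning ≈-setoid

module _ {N : ℕ} (cyc : CyclotomicUpTo N) where

  xⁿ-1-∣-properProduct : ∀ {g d} → 1 ≤ g → g ∣ d → g < d → d ≤ N → xⁿ-1 g ∣ₚ properProduct d
  xⁿ-1-∣-properProduct {g} {d} 1≤g g∣d g<d d≤N =
    ∣ₚ-respˡ-≈ (∏Φ-divisors≈xⁿ-1 1≤g (cyc 1≤g (ℕP.≤-trans (ℕP.<⇒≤ g<d) d≤N)))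
      (∣ₚ-trans (∏Φ-filter-∣ₚ (_∣? g) (_∣? d) (λ x∣g → ∣-trans x∣g g∣d) (oneTo g))
                (∏Φ-divisorsUpTo-mono d (<⇒≤∸1 g<d)))

  -- With δ = gcd d e and d = kδ: Φ_d R = (xᵈ - 1)/(x^δ - 1) ≡ k mod x^δ - 1, and x^δ - 1 lies in (xᵈ - 1, xᵉ - 1).
  Φ-coprime-xⁿ-1 : ∀ {d e} → 1 ≤ d → d ≤ N → ¬ d ∣ e → Coprimeₚ (Φ d) (xⁿ-1 e)
  Φ-coprime-xⁿ-1 {d} {e} 1≤d d≤N d∤e with gcd[m,n]∣m d e
  ... | divides k d≡kδ = Coprimeₚ-via-cofactor k≢0 Φd*R*Xδ≈Xd
    (proj₁ (geometric-mod-xⁿ-1 δ k) , ≈-trans Φd*R≈G (proj₂ (geometric-mod-xⁿ-1 δ k)))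
    (xⁿ-1-bezout d e)
    where
    δ = gcd d e
    d≢0 : d ≢ 0
    d≢0 refl = ℕP.<⇒≢ 1≤d refl
    1≤δ : 1 ≤ δ
    1≤δ = ℕP.n≢0⇒n>0 (gcd[m,n]≢0 d e (inj₁ d≢0))
    k≢0 : ℤ.+ k ≢ 0ℤ
    k≢0 refl = d≢0 d≡kδ
    δ<d : δ < d
    δ<d = ℕP.≤∧≢⇒< (∣⇒≤ {{ℕ.≢-nonZero d≢0}} (gcd[m,n]∣m d e)) λ δ≡d → d∤e (subst (_∣ e) δ≡d (gcd[m,n]∣n d e))
    R = proj₁ (xⁿ-1-∣-properProduct 1≤δ (gcd[m,n]∣m d e) δ<d d≤N)
    Φd*R*Xδ≈Xd : Φ d *ₚ R *ₚ xⁿ-1 δ ≈ xⁿ-1 d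
    Φd*R*Xδ≈Xd = ≈-trans (*ₚ-assoc (Φ d) R (xⁿ-1 δ))
      (≈-trans (*ₚ-cong (≈-refl {Φ d}) (proj₂ (xⁿ-1-∣-properProduct 1≤δ (gcd[m,n]∣m d e) δ<d d≤N)))
               (factorisation (cyc 1≤d d≤N)))
    Φd*R≈G : Φ d *ₚ R ≈ geometric δ k
    Φd*R≈G = *ₚ-cancelʳ-monic (Monic-xⁿ-1 δ 1≤δ) (Φ d *ₚ R) (geometric δ k)
      (≈-trans Φd*R*Xδ≈Xd (≈-sym (≈-trans (geometric-*ₚ-xⁿ-1 δ k) (≈-reflexive (cong xⁿ-1 (sym d≡kδ))))))

  Φ-coprime-Φ : ∀ {d e} → d ≢ e → 1 ≤ d → d ≤ N → 1 ≤ e → e ≤ N → Coprimeₚ (Φ d) (Φ e)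
  Φ-coprime-Φ {d} {e} d≢e 1≤d d≤N 1≤e e≤N with d ∣? e
  ... | no d∤e  = Coprimeₚ-∣ₚ (Φ-coprime-xⁿ-1 1≤d d≤N d∤e) (∣xⁿ-1 (cyc 1≤e e≤N))
  ... | yes d∣e = Coprimeₚ-sym
    (Coprimeₚ-∣ₚ (Φ-coprime-xⁿ-1 1≤e e≤N λ e∣d → d≢e (∣-antisym d∣e e∣d)) (∣xⁿ-1 (cyc 1≤d d≤N)))

  Φ-coprime-∏Φ : ∀ {d} → 1 ≤ d → d ≤ N → ∀ es → All (λ e → 1 ≤ e × e ≤ N × e ≢ d) es → Coprimeₚ (Φ d) (∏Φ es)
  Φ-coprime-∏Φ 1≤d d≤N []       []                       = Coprimeₚ-1ₚ _
  Φ-coprime-∏Φ 1≤d d≤N (e ∷ es) ((1≤e , e≤N , e≢d) ∷ bs) =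
    Coprimeₚ-*ₚ (Φ-coprime-Φ (λ d≡e → e≢d (sym d≡e)) 1≤d d≤N 1≤e e≤N) (Φ-coprime-∏Φ 1≤d d≤N es bs)

  private
    divisors-cyclotomic : ∀ {n} k → k ≤ N → All IsCyclotomic (divisorsUpTo n k)
    divisors-cyclotomic {n} k k≤N = All.map (λ (1≤d , d≤k) → cyc 1≤d (ℕP.≤-trans d≤k k≤N)) (divisorsUpTo-bounds n k)

  ∏Φ-divisors-∣ : ∀ k → k ≤ N → ∏Φ (divisorsUpTo (suc N) k) ∣ₚ xⁿ-1 (suc N)
  ∏Φ-divisors-∣ zero    _     = xⁿ-1 (suc N) , *ₚ-identityʳ _
  ∏Φ-divisors-∣ (suc k) k<N with suc k ∣? suc N
  ... | no k+1∤n = ∣ₚ-respˡ-≈ (≈-sym (begin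
    ∏Φ (divisorsUpTo (suc N) (suc k))                                ≈⟨ ∏Φ-divisorsUpTo-suc (suc N) k ⟩
    ∏Φ (divisorsUpTo (suc N) k) *ₚ ∏Φ (filter (_∣? suc N) [ suc k ]) ≈⟨ *ₚ-cong (≈-refl {ds}) (∏Φ-[x]-reject k+1∤n) ⟩
    ∏Φ (divisorsUpTo (suc N) k) *ₚ 1ₚ                                ≈⟨ *ₚ-identityʳ _ ⟩
    ∏Φ (divisorsUpTo (suc N) k)                                      ∎))
    (∏Φ-divisors-∣ k (ℕP.<⇒≤ k<N))
    where
    open SetoidReasoning ≈-setoid
    ds = ∏Φ (divisorsUpTo (suc N) k)
  ... | yes k+1∣n = ∣ₚ-respˡ-≈ (≈-sym (≈-trans (∏Φ-divisorsUpTo-suc (suc N) k)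
                                                (*ₚ-cong (≈-refl {∏Φ (divisorsUpTo (suc N) k)}) (∏Φ-[x]-accept k+1∣n))))
    (*ₚ-∣ₚ-coprime (Monic-*ₚ {p = ∏Φ (divisorsUpTo (suc N) k)} (proj₁ (∏Φ-monic _ (divisors-cyclotomic k k≤N))) (monic cyc-k+1))
                   (∏Φ-divisors-∣ k k≤N)
                   (∣ₚ-trans (∣xⁿ-1 cyc-k+1) (xⁿ-1-∣ k+1∣n))
                   (Coprimeₚ-sym (Φ-coprime-∏Φ (s≤s z≤n) k<N (divisorsUpTo (suc N) k)
                     (All.map (λ (1≤e , e≤k) → 1≤e , ℕP.≤-trans e≤k k≤N , ℕP.<⇒≢ (s≤s e≤k)) (divisorsUpTo-bounds (suc N) k)))))
    where
    k≤N = ℕP.<⇒≤ k<N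
    cyc-k+1 = cyc (s≤s z≤n) k<N

  IsCyclotomic-suc : IsCyclotomic (suc N)
  IsCyclotomic-suc = record
    { monic         = Monic-cong (≈-sym Φn≈T) monic-T
    ; factorisation = ≈-trans (*ₚ-cong Φn≈T (≈-refl {Q})) T*Q≈xⁿ-1
    ; unitConstant  = trans (cong (λ w → w ℤ.* w) (at Φn≈T 0)) unit-T
    }
    where
    n = suc N
    Q = properProduct n
    S = sum (map totient (divisorsUpTo n N))
    T = proj₁ (∏Φ-divisors-∣ N ℕP.≤-refl)
    T*Q≈xⁿ-1 : T *ₚ Q ≈ xⁿ-1 n
    T*Q≈xⁿ-1 = proj₂ (∏Φ-divisors-∣ N ℕP.≤-refl)
    monic-Q = ∏Φ-monic (divisorsUpTo n N) (divisors-cyclotomic N ℕP.≤-refl)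
    S+φ≡n : S + totient n ≡ n
    S+φ≡n = sum-totient-properDivisors N
    monic-T : Monic (totient n) T
    monic-T = subst (λ D → Monic D T) (trans (cong (_∸ S) (sym S+φ≡n)) (ℕP.m+n∸m≡n S (totient n)))
      (Monic-quotient {q = Q} {t = T} (proj₁ monic-Q) (Monic-xⁿ-1 n (s≤s z≤n))
                      (ℕP.≤-trans (ℕP.m≤m+n S _) (ℕP.≤-reflexive S+φ≡n)) T*Q≈xⁿ-1)
    Φn≈T : Φ n ≈ T
    Φn≈T = ≈-trans (≈-reflexive (Φ-unfold N))
      (sdiv-unique (suc n) (xⁿ-1 n) Q T (proj₂ monic-Q) T*Q≈xⁿ-1
        λ j le → proj₂ monic-T j (ℕP.≤-trans (s≤s (ℕP.≤-trans (ℕP.m≤n+m (totient n) S) (ℕP.≤-reflexive S+φ≡n))) le))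
    unit-T : coeff T 0 ℤ.* coeff T 0 ≡ 1ℤ
    unit-T = begin
      t₀ ℤ.* t₀                   ≡⟨ ℤP.*-identityʳ _ ⟨
      t₀ ℤ.* t₀ ℤ.* 1ℤ            ≡⟨ cong (t₀ ℤ.* t₀ ℤ.*_) (proj₂ monic-Q) ⟨
      t₀ ℤ.* t₀ ℤ.* (q₀ ℤ.* q₀)   ≡⟨ regroup t₀ q₀ ⟩
      (t₀ ℤ.* q₀) ℤ.* (t₀ ℤ.* q₀) ≡⟨ cong (λ w → w ℤ.* w) (trans (sym (coeff-*ₚ T Q 0)) (at T*Q≈xⁿ-1 0)) ⟩
      1ℤ                          ∎
      where
      open ≡-Reasoning
      t₀ = coeff T 0
      q₀ = coeff Q 0
      regroup : ∀ t q → t ℤ.* t ℤ.* (q ℤ.* q) ≡ (t ℤ.* q) ℤ.* (t ℤ.* q)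
      regroup = solve-∀

cyclotomicUpTo : ∀ N → CyclotomicUpTo N
cyclotomicUpTo zero    1≤d d≤0 = ⊥-elim (ℕP.<⇒≱ 1≤d d≤0)
cyclotomicUpTo (suc N) 1≤d d≤1+N with ℕP.m≤n⇒m<n∨m≡n d≤1+N
... | inj₁ (s≤s d≤N) = cyclotomicUpTo N 1≤d d≤N
... | inj₂ refl      = IsCyclotomic-suc (cyclotomicUpTo N)

cyclotomic : ∀ {d} → 1 ≤ d → IsCyclotomic d
cyclotomic 1≤d = cyclotomicUpTo _ 1≤d ℕP.≤-refl

-- Φ_{mp} divides Φ_m(xᵖ)

module _ (n : ℕ) where

  Coprimeₚ-expand-∏Φ : ∀ {a} ds → All (λ d → Coprimeₚ a (expand (suc n) (Φ d))) ds → Coprimeₚ a (expand (suc n) (∏Φ ds))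
  Coprimeₚ-expand-∏Φ []       []           = Coprimeₚ-respʳ-≈ (≈-sym (expand-1ₚ n)) (Coprimeₚ-1ₚ _)
  Coprimeₚ-expand-∏Φ (d ∷ ds) (cop ∷ cops) =
    Coprimeₚ-respʳ-≈ (≈-sym (expand-*ₚ n (Φ d) (∏Φ ds))) (Coprimeₚ-*ₚ cop (Coprimeₚ-expand-∏Φ ds cops))

  -- Φ_{mp} is coprime to Φ_d(xᵖ) for d ∣ m, d < m, as the latter divides x^{dp} - 1 and mp ∤ dp.
  Φ-∣-expand-Φ : ∀ {m} → 1 ≤ m → Φ (m * suc n) ∣ₚ expand (suc n) (Φ m)
  Φ-∣-expand-Φ {m} 1≤m = coprime-∣ₚ-*ₚ⇒∣ₚ (monic cyc-mp)
    (∣ₚ-respʳ-≈ (≈-sym expand-factorisation) (∣xⁿ-1 cyc-mp))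
    (Coprimeₚ-expand-∏Φ (divisorsUpTo m (m ∸ 1)) (All.map coprime-factor (divisorsUpTo-bounds m (m ∸ 1))))
    where
    open SetoidReasoning ≈-setoid
    1≤mp : 1 ≤ m * suc n
    1≤mp = ℕP.*-mono-≤ 1≤m (s≤s z≤n)
    cyc-mp = cyclotomic 1≤mp
    expand-factorisation : expand (suc n) (Φ m) *ₚ expand (suc n) (properProduct m) ≈ xⁿ-1 (m * suc n)
    expand-factorisation = begin
      expand (suc n) (Φ m) *ₚ expand (suc n) (properProduct m) ≈⟨ expand-*ₚ n (Φ m) (properProduct m) ⟨
      expand (suc n) (Φ m *ₚ properProduct m)                  ≈⟨ expand-cong n (factorisation (cyclotomic 1≤m)) ⟩
      expand (suc n) (xⁿ-1 m)                                  ≈⟨ expand-xⁿ-1 n m ⟩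
      xⁿ-1 (m * suc n)                                         ∎
    coprime-factor : ∀ {d} → 1 ≤ d × d ≤ m ∸ 1 → Coprimeₚ (Φ (m * suc n)) (expand (suc n) (Φ d))
    coprime-factor {d} (1≤d , d≤m-1) =
      Coprimeₚ-∣ₚ (Φ-coprime-xⁿ-1 (cyclotomicUpTo (m * suc n)) 1≤mp ℕP.≤-refl mp∤dp)
                  (expand (suc n) (properProduct d) , ≈-trans (≈-sym (expand-*ₚ n (properProduct d) (Φ d)))
                    (≈-trans (expand-cong n (≈-trans (*ₚ-comm (properProduct d) (Φ d)) (factorisation (cyclotomic 1≤d))))
                             (expand-xⁿ-1 n d)))
      where
      d<m : d < m
      d<m = ℕP.≤-trans (s≤s d≤m-1) (ℕP.≤-reflexive (ℕP.m+[n∸m]≡n 1≤m))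
      mp∤dp : ¬ m * suc n ∣ d * suc n
      mp∤dp mp∣dp = ℕP.<⇒≱ (ℕP.*-monoˡ-< (suc n) d<m) (∣⇒≤ {{ℕ.>-nonZero (ℕP.*-mono-≤ 1≤d (s≤s z≤n))}} mp∣dp)

expand-Φ-cofactor : ∀ {m p} → 1 ≤ m → Prime p → ¬ p ∣ m →
                    Σ Poly λ h → Monic (totient m) h × (Φ (m * p) *ₚ h ≈ expand p (Φ m))
expand-Φ-cofactor {m} {p@(suc n)} 1≤m p-prime p∤m =
  h , subst (λ D → Monic D h) deg≡φ
        (Monic-quotient {q = Φ (m * p)} {t = h} (monic (cyclotomic (ℕP.*-mono-≤ 1≤m (s≤s z≤n))))
          (subst (λ D → Monic D (expand p (Φ m))) (ℕP.*-comm (totient m) p) (Monic-expand n {p = Φ m} (monic (cyclotomic 1≤m))))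
          φ[mp]≤pφ[m] (proj₂ (Φ-∣-expand-Φ n 1≤m))) ,
  ≈-trans (*ₚ-comm (Φ (m * p)) h) (proj₂ (Φ-∣-expand-Φ n 1≤m))
  where
  h = proj₁ (Φ-∣-expand-Φ n 1≤m)
  φ-identity : totient (m * p) + totient m ≡ p * totient m
  φ-identity = totient-*-prime p-prime m p∤m
  φ[mp]≤pφ[m] : totient (m * p) ≤ p * totient m
  φ[mp]≤pφ[m] = ℕP.≤-trans (ℕP.m≤m+n _ _) (ℕP.≤-reflexive φ-identity)
  deg≡φ : p * totient m ∸ totient (m * p) ≡ totient m
  deg≡φ = trans (cong (_∸ totient (m * p)) (sym φ-identity)) (ℕP.m+n∸m≡n (totient (m * p)) (totient m))

-- Gaps in the blocks of Φ_{mp}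

conv-initial-zero : ∀ f g n → (∀ j → j ≤ n → f j ≡ 0ℤ) → conv f g n ≡ 0ℤ
conv-initial-zero f g zero    z = trans (cong (ℤ._* g 0) (z 0 z≤n)) (ℤP.*-zeroˡ (g 0))
conv-initial-zero f g (suc n) z =
  cong₂ ℤ._+_ (trans (cong (ℤ._* g (suc n)) (z 0 z≤n)) (ℤP.*-zeroˡ (g (suc n))))
              (conv-initial-zero (f ∘ suc) g n λ j j≤n → z (suc j) (s≤s j≤n))

-- Of the terms f i · g (P + D - i) only i = P survives: f vanishes on (P, P + D] and g above D.
conv-window : ∀ D g → g D ≡ 1ℤ → Vanishes (suc D) g →
              ∀ P f → (∀ t → 1 ≤ t → t ≤ D → f (P + t) ≡ 0ℤ) → conv f g (P + D) ≡ f P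
conv-window zero    g top above zero f gap = trans (cong (f 0 ℤ.*_) top) (ℤP.*-identityʳ (f 0))
conv-window (suc D) g top above zero f gap =
  trans (cong₂ ℤ._+_ (trans (cong (f 0 ℤ.*_) top) (ℤP.*-identityʳ (f 0)))
                     (conv-initial-zero (f ∘ suc) g D λ j j≤D → gap (suc j) (s≤s z≤n) (s≤s j≤D)))
        (ℤP.+-identityʳ (f 0))
conv-window D g top above (suc P) f gap =
  trans (cong₂ ℤ._+_ (trans (cong (f 0 ℤ.*_) (above (suc (P + D)) (s≤s (ℕP.m≤n+m D P)))) (ℤP.*-zeroʳ (f 0)))
                     (conv-window D g top above P (f ∘ suc) gap))
        (ℤP.+-identityˡ _)

-- Φ_{mp} h = Φ_m(xᵖ) has no terms strictly inside a block [ip, ip + p).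
Φ-zero-run : ∀ {m p} → 1 ≤ m → Prime p → ¬ p ∣ m → ∀ i a → a + totient m < p →
             (∀ t → 1 ≤ t → t ≤ totient m → coeff (Φ (m * p)) (i * p + a + t) ≡ 0ℤ) →
             coeff (Φ (m * p)) (i * p + a) ≡ 0ℤ
Φ-zero-run {m} {p@(suc n)} 1≤m p-prime p∤m i a a+D<p zeros = begin
  coeff (Φ (m * p)) (i * p + a)
    ≡⟨ conv-window D (coeff h) (proj₁ monic-h) (proj₂ monic-h) (i * p + a) (coeff (Φ (m * p))) zeros ⟨
  conv (coeff (Φ (m * p))) (coeff h) (i * p + a + D) ≡⟨ coeff-*ₚ (Φ (m * p)) h _ ⟨
  coeff (Φ (m * p) *ₚ h) (i * p + a + D)             ≡⟨ at Φmp*h≈ (i * p + a + D) ⟩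
  coeff (expand p (Φ m)) (i * p + a + D)
    ≡⟨ cong (coeff (expand p (Φ m))) (trans (ℕP.+-assoc (i * p) a D) (cong (i * p +_) (sym 1+r≡a+D))) ⟩
  coeff (expand p (Φ m)) (i * p + suc r)             ≡⟨ coeff-expand-nonmultiple n (Φ m) i r r<n ⟩
  0ℤ                                                 ∎
  where
  open ≡-Reasoning
  D = totient m
  h = proj₁ (expand-Φ-cofactor 1≤m p-prime p∤m)
  monic-h = proj₁ (proj₂ (expand-Φ-cofactor 1≤m p-prime p∤m))
  Φmp*h≈ = proj₂ (proj₂ (expand-Φ-cofactor 1≤m p-prime p∤m))
  r = ℕ.pred (a + D)
  1+r≡a+D : suc r ≡ a + D
  1+r≡a+D = ℕP.suc-pred (a + D) {{ℕ.>-nonZero (ℕP.≤-trans (totient-positive m 1≤m) (ℕP.m≤n+m D a))}}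
  r<n : r < n
  r<n = ℕP.≤-pred (ℕP.≤-trans (ℕP.≤-reflexive (cong suc 1+r≡a+D)) a+D<p)

countFrom : ℕ → ℕ → List ℕ
countFrom s zero    = []
countFrom s (suc k) = s ∷ countFrom (suc s) k

upTo≡countFrom : ∀ n → upTo n ≡ countFrom 0 n
upTo≡countFrom = applyUpTo-shift id 0 (λ _ → refl)
  where
  applyUpTo-shift : ∀ (f : ℕ → ℕ) s → (∀ x → f x ≡ s + x) → ∀ n → applyUpTo f n ≡ countFrom s n
  applyUpTo-shift f s f≡ zero    = refl
  applyUpTo-shift f s f≡ (suc n) =
    cong₂ _∷_ (trans (f≡ 0) (ℕP.+-identityʳ s)) (applyUpTo-shift (f ∘ suc) (suc s) (λ x → trans (f≡ (suc x)) (ℕP.+-suc s x)) n)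

module _ {P : Pred ℕ 0ℓ} (P? : Decidable P) (D m : ℕ)
         (gap≤ : ∀ {a b} → a < b → b < m → P a → P b → (∀ {j} → a < j → j < b → ¬ P j) → b ∸ a ≤ D) where

  private
    maxGap-after : ∀ k s a → s + k ≤ m → P a → a < s → (∀ {j} → a < j → j < s → ¬ P j) →
                   maxGapList (a ∷ filter P? (countFrom s k)) ≤ D
    maxGap-after zero    s a _ _ _ _ = z≤n
    maxGap-after (suc k) s a s+k<m pa a<s between with P? s
    ... | yes ps = ℕP.⊔-lub (gap≤ a<s s<m pa ps between)
                            (maxGap-after k (suc s) s s+1+k≤m ps ℕP.≤-refl λ s<j j<1+s _ → ℕP.<⇒≱ s<j (ℕP.≤-pred j<1+s))
      where
      s+1+k≤m = ℕP.≤-trans (ℕP.≤-reflexive (sym (ℕP.+-suc s k))) s+k<m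
      s<m = ℕP.≤-trans (s≤s (ℕP.m≤m+n s k)) s+1+k≤m
    ... | no ¬ps = maxGap-after k (suc s) a (ℕP.≤-trans (ℕP.≤-reflexive (sym (ℕP.+-suc s k))) s+k<m) pa (ℕP.m≤n⇒m≤1+n a<s) between′
      where
      between′ : ∀ {j} → a < j → j < suc s → ¬ P j
      between′ {j} a<j (s≤s j≤s) with ℕP.m≤n⇒m<n∨m≡n j≤s
      ... | inj₁ j<s = between a<j j<s
      ... | inj₂ refl = ¬ps

    maxGap-from : ∀ k s → s + k ≤ m → maxGapList (filter P? (countFrom s k)) ≤ D
    maxGap-from zero    s _ = z≤n
    maxGap-from (suc k) s s+k<m with P? s
    ... | yes ps = maxGap-after k (suc s) s (ℕP.≤-trans (ℕP.≤-reflexive (sym (ℕP.+-suc s k))) s+k<m) ps ℕP.≤-refl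
                     λ s<j j<1+s _ → ℕP.<⇒≱ s<j (ℕP.≤-pred j<1+s)
    ... | no _   = maxGap-from k (suc s) (ℕP.≤-trans (ℕP.≤-reflexive (sym (ℕP.+-suc s k))) s+k<m)

  maxGapList-filter-upTo : maxGapList (filter P? (upTo m)) ≤ D
  maxGapList-filter-upTo = subst (λ xs → maxGapList (filter P? xs) ≤ D) (sym (upTo≡countFrom m)) (maxGap-from m 0 ℕP.≤-refl)

g≤ : ∀ f D → (∀ {a b} → a < b → b < length f → coeff f a ≢ 0ℤ → coeff f b ≢ 0ℤ →
                (∀ {j} → a < j → j < b → coeff f j ≡ 0ℤ) → b ∸ a ≤ D) → g f ≤ D
g≤ f D gap≤ = maxGapList-filter-upTo (λ k → ¬? (coeff f k ℤ.≟ 0ℤ)) D (length f) λ a<b b<n fa≢0 fb≢0 between →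
  gap≤ a<b b<n fa≢0 fb≢0 λ {j} a<j j<b → decidable-stable (coeff f j ℤ.≟ 0ℤ) (between a<j j<b)

module _ {m p : ℕ} (1≤m : 1 ≤ m) (p-prime : Prime p) (m<p : m < p) where

  Φ-block-gap≤ : ∀ i {a b} → a < b → b < m → coeff (Φ (m * p)) (i * p + a) ≢ 0ℤ →
                 (∀ {j} → a < j → j < b → coeff (Φ (m * p)) (i * p + j) ≡ 0ℤ) → b ∸ a ≤ totient m
  Φ-block-gap≤ i {a} {b} a<b b<m Φa≢0 between with b ∸ a ℕ.≤? totient m
  ... | yes b-a≤D = b-a≤D
  ... | no  b-a≰D = ⊥-elim (Φa≢0 (Φ-zero-run 1≤m p-prime p∤m i a (ℕP.<-trans a+D<b (ℕP.<-trans b<m m<p)) zeros))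
    where
    p∤m : ¬ p ∣ m
    p∤m p∣m = ℕP.<⇒≱ m<p (∣⇒≤ {{ℕ.>-nonZero 1≤m}} p∣m)
    a+D<b : a + totient m < b
    a+D<b = ℕP.≤-trans (ℕP.+-monoʳ-< a (ℕP.≰⇒> b-a≰D)) (ℕP.≤-reflexive (ℕP.m+[n∸m]≡n (ℕP.<⇒≤ a<b)))
    zeros : ∀ t → 1 ≤ t → t ≤ totient m → coeff (Φ (m * p)) (i * p + a + t) ≡ 0ℤ
    zeros t 1≤t t≤D = trans (cong (coeff (Φ (m * p))) (ℕP.+-assoc (i * p) a t))
      (between (ℕP.≤-trans (ℕP.≤-reflexive (ℕP.+-comm 1 a)) (ℕP.+-monoʳ-≤ a 1≤t)) (ℕP.≤-<-trans (ℕP.+-monoʳ-≤ a t≤D) a+D<b))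

coeff-map-upTo : ∀ (f : ℕ → ℤ) n {k} → k < n → coeff (map f (upTo n)) k ≡ f k
coeff-map-upTo f n k<n = trans (cong (λ xs → coeff xs _) (LP.map-upTo f n)) (coeff-applyUpTo f n k<n)
  where
  coeff-applyUpTo : ∀ (f : ℕ → ℤ) n {k} → k < n → coeff (applyUpTo f n) k ≡ f k
  coeff-applyUpTo f (suc n) {zero}  _         = refl
  coeff-applyUpTo f (suc n) {suc k} (s≤s k<n) = coeff-applyUpTo (f ∘ suc) n k<n

coeff-fmpij : ∀ m p i j {k} → k < m → j * m + k < p → coeff (fmpij m p i j) k ≡ coeff (Φ (m * p)) (i * p + (j * m + k))
coeff-fmpij m p i j k<m jm+k<p =
  trans (coeff-map-upTo (λ k → coeff (fmpi m p i) (j * m + k)) m k<m)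
        (coeff-map-upTo (λ k → coeff (Φ (m * p)) (i * p + k)) p jm+k<p)

length-fmpij : ∀ m p i j → length (fmpij m p i j) ≡ m
length-fmpij m p i j = trans (LP.length-map _ (upTo m)) (LP.length-upTo m)

mainTheorem7 : (m p : ℕ) → 1 ≤ m → Prime p → m < p →
    (i : ℕ) → i < totient m → g (fmpij m p i 0) ≤ totient m
mainTheorem7 m p 1≤m p-prime m<p i _ = g≤ f (totient m) λ a<b b<len fa≢0 _ between →
  Φ-block-gap≤ 1≤m p-prime m<p i a<b (b<m b<len) (fa≢0 ∘ trans (coeff-f (ℕP.<-trans a<b (b<m b<len))))
    λ a<j j<b → trans (sym (coeff-f (ℕP.<-trans j<b (b<m b<len)))) (between a<j j<b)
  where
  f = fmpij m p i 0
  b<m : ∀ {b} → b < length f → b < m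
  b<m = subst (_ <_) (length-fmpij m p i 0)
  coeff-f : ∀ {k} → k < m → coeff f k ≡ coeff (Φ (m * p)) (i * p + k)
  coeff-f k<m = coeff-fmpij m p i 0 k<m (ℕP.<-trans k<m m<p)
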